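{- Let $H\in M_N(\pm1)$ be an Hadamard matrix, i.e. a matrix with entries $\pm1$ whose rows are pairwise orthogonal. For $(a,b)\in\{\pm1\}^N\times\{\pm1\}^N$ put $\Omega(a,b)=\sum_{i,j=1}^N a_ib_jH_{ij}$, and regard $\Omega$ as a random variable with $(a,b)$ uniformly distributed on $\{\pm1\}^N\times\{\pm1\}^N$. Then for every integer $p\geq1$, $$\int_{\{\pm1\}^N\times\{\pm1\}^N}\left(\frac{\Omega}{N}\right)^{2p}=(2p-1)(2p-3)\cdots3\cdot1+O(N^{ -1}),$$ where the implied constant depends only on $p$. In particular, for any sequence of Hadamard matrices of sizes $N\to\infty$, the variable $\Omega/N$ converges in distribution to the standard real Gaussian law $\mathcal N(0,1)$.
   Context: The integral is with respect to the uniform probability measure on $\{\pm1\}^N\times\{\pm1\}^N$. -}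

module Defs where

open import Data.Nat as ℕ using (ℕ; zero; suc; NonZero)
open import Data.Fin using (Fin; zero; suc)
open import Data.Integer as ℤ using (ℤ; +_; -[1+_])
open import Data.Rational as ℚ using (ℚ; ½; 0ℚ; 1ℚ; _/_)
open import Data.Sum using (_⊎_)
open import Relation.Binary.PropositionalEquality using (_≡_; _≢_)

IsSign : ℤ → Set
IsSign x = (x ≡ + 1) ⊎ (x ≡ -[1+ 0 ])

sumFin : (n : ℕ) → (Fin n → ℤ) → ℤ
sumFin zero    f = + 0
sumFin (suc n) f = f zero ℤ.+ sumFin n (λ i → f (suc i))

IsHadamard : (N : ℕ) → (Fin N → Fin N → ℤ) → Set
IsHadamard N H =
  ((i j : Fin N) → IsSign (H i j)) ×'
  ((i j : Fin N) → i ≢ j → sumFin N (λ k → H i k ℤ.* H j k) ≡ + 0)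
  where
  open import Data.Product using () renaming (_×_ to _×'_)

Omega : (N : ℕ) → (Fin N → Fin N → ℤ) → (Fin N → ℤ) → (Fin N → ℤ) → ℤ
Omega N H a b = sumFin N (λ i → sumFin N (λ j → a i ℤ.* b j ℤ.* H i j))

cons : {n : ℕ} → ℤ → (Fin n → ℤ) → (Fin (suc n) → ℤ)
cons x a zero    = x
cons x a (suc i) = a i

-- Expectation of f over a uniformly distributed a ∈ {±1}^n
-- (i.e. 2^{-n} Σ_{a ∈ {±1}^n} f a), computed coordinate by coordinate.
avgSigns : (n : ℕ) → ((Fin n → ℤ) → ℚ) → ℚ
avgSigns zero    f = f (λ ())
avgSigns (suc n) f =
  ½ ℚ.* (avgSigns n (λ a → f (cons (+ 1) a)) ℚ.+ avgSigns n (λ a → f (cons -[1+ 0 ] a)))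

powℚ : ℚ → ℕ → ℚ
powℚ q zero    = 1ℚ
powℚ q (suc k) = q ℚ.* powℚ q k

oddDoubleFactorial : ℕ → ℕ
oddDoubleFactorial zero    = 1
oddDoubleFactorial (suc p) = (2 ℕ.* p ℕ.+ 1) ℕ.* oddDoubleFactorial p

moment : (N : ℕ) .{{_ : NonZero N}} → (Fin N → Fin N → ℤ) → ℕ → ℚ
moment N H p =
  avgSigns N (λ a → avgSigns N (λ b → powℚ (Omega N H a b / N) (2 ℕ.* p)))

-- Write Ω(a,b) = Σⱼ bⱼ cⱼ with cⱼ = Σᵢ aᵢ Hᵢⱼ.  For fixed a, the average over b of
-- Ω^(2p) is the 2p-th moment of a Rademacher sum.  Splitting off one sign at a time,
-- only even powers survive, and comparing the resulting recursion with the binomial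
-- expansion of (Σ cⱼ²)^p shows that this moment lies between
-- (2p-1)!! (Σ cⱼ²)^p - K_p (Σ cⱼ⁴) (Σ cⱼ²)^(p-2) and (2p-1)!! (Σ cⱼ²)^p.
-- For a Hadamard matrix the rows are orthogonal, so Σ cⱼ² = N² for every sign vector a,
-- and the same upper bound with p = 2, applied to each column, makes the average of
-- Σ cⱼ⁴ at most 3N³.  After dividing by N^(2p) the error is at most 3 K_p / N.
module Submission where

open import Defs
open import Data.Nat using (ℕ; NonZero)
open import Data.Fin using (Fin)
open import Data.Integer using (ℤ)

module Combinatorics where
  open import Data.Nat
  open import Data.Nat.Properties
  open import Data.Nat.Combinatorics using (_C_; nCk≡n!/k![n-k]!; k![n∸k]!∣n!; nC1≡n)
  open import Data.Nat.DivMod using (m/n*n≡m)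
  open import Data.Nat.Tactic.RingSolver using (solve-∀)
  open import Relation.Binary.PropositionalEquality

  D : ℕ → ℕ
  D = oddDoubleFactorial

  D≢0 : ∀ p → NonZero (D p)
  D≢0 zero    = _
  D≢0 (suc p) = m*n≢0 (2 * p + 1) (D p) {{subst NonZero (+-comm 1 (2 * p)) _}} {{D≢0 p}}

  D[p]*2^p*p!≡[2p]! : ∀ p → D p * (2 ^ p * p !) ≡ (2 * p) !
  D[p]*2^p*p!≡[2p]! zero    = refl
  D[p]*2^p*p!≡[2p]! (suc p) = begin
    (2 * p + 1) * D p * (2 * 2 ^ p * (suc p * p !))        ≡⟨ regroup p (D p) (2 ^ p) (p !) ⟩
    (2 + 2 * p) * ((1 + 2 * p) * (D p * (2 ^ p * p !)))    ≡⟨ cong (λ f → (2 + 2 * p) * ((1 + 2 * p) * f)) (D[p]*2^p*p!≡[2p]! p) ⟩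
    (2 + 2 * p) !                                          ≡⟨ cong _! (sym (*-suc 2 p)) ⟩
    (2 * suc p) !                                          ∎
    where
    open ≡-Reasoning
    regroup : ∀ p d t f → (2 * p + 1) * d * (2 * t * (suc p * f)) ≡ (2 + 2 * p) * ((1 + 2 * p) * (d * (t * f)))
    regroup = solve-∀

  [k+m]Ck*k!*m!≡[k+m]! : ∀ k m → ((k + m) C k) * (k ! * m !) ≡ (k + m) !
  [k+m]Ck*k!*m!≡[k+m]! k m = begin
    ((k + m) C k) * (k ! * m !)                                          ≡⟨ cong (λ j → ((k + m) C k) * (k ! * j !)) (sym (m+n∸m≡n k m)) ⟩
    ((k + m) C k) * (k ! * (k + m ∸ k) !)                                ≡⟨ cong (_* (k ! * (k + m ∸ k) !)) (nCk≡n!/k![n-k]! (m≤m+n k m)) ⟩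
    ((k + m) ! / (k ! * (k + m ∸ k) !)) {{_}} * (k ! * (k + m ∸ k) !)    ≡⟨ m/n*n≡m {{_}} (k![n∸k]!∣n! (m≤m+n k m)) ⟩
    (k + m) !                                                            ∎
    where open ≡-Reasoning

  -- Both sides, multiplied by 2^(k+m) k! m!, equal (2(k+m))!.
  C[2p,2k]*D[p∸k]*D[k]≡C[p,k]*D[p] : ∀ k m → ((2 * (k + m)) C (2 * k)) * D m * D k ≡ ((k + m) C k) * D (k + m)
  C[2p,2k]*D[p∸k]*D[k]≡C[p,k]*D[p] k m = *-cancelʳ-≡ _ _ (2 ^ (k + m) * (k ! * m !)) {{weight≢0}} (trans lhs (sym rhs))
    where
    open ≡-Reasoning
    weight≢0 : NonZero (2 ^ (k + m) * (k ! * m !))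
    weight≢0 = m*n≢0 _ _ {{m^n≢0 2 (k + m)}} {{m*n≢0 _ _ {{k !≢0}} {{m !≢0}}}}
    regroup₁ : ∀ c dm dk t₁ t₂ f₁ f₂ →
      c * dm * dk * ((t₁ * t₂) * (f₁ * f₂)) ≡ c * ((dk * (t₁ * f₁)) * (dm * (t₂ * f₂)))
    regroup₁ = solve-∀
    regroup₂ : ∀ c d t f → c * d * (t * f) ≡ d * (t * (c * f))
    regroup₂ = solve-∀
    lhs : ((2 * (k + m)) C (2 * k)) * D m * D k * (2 ^ (k + m) * (k ! * m !)) ≡ (2 * (k + m)) !
    lhs = begin
      ((2 * (k + m)) C (2 * k)) * D m * D k * (2 ^ (k + m) * (k ! * m !))
        ≡⟨ cong (λ t → ((2 * (k + m)) C (2 * k)) * D m * D k * (t * (k ! * m !))) (^-distribˡ-+-* 2 k m) ⟩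
      ((2 * (k + m)) C (2 * k)) * D m * D k * ((2 ^ k * 2 ^ m) * (k ! * m !))
        ≡⟨ regroup₁ ((2 * (k + m)) C (2 * k)) (D m) (D k) (2 ^ k) (2 ^ m) (k !) (m !) ⟩
      ((2 * (k + m)) C (2 * k)) * ((D k * (2 ^ k * k !)) * (D m * (2 ^ m * m !)))
        ≡⟨ cong₂ (λ a b → ((2 * (k + m)) C (2 * k)) * (a * b)) (D[p]*2^p*p!≡[2p]! k) (D[p]*2^p*p!≡[2p]! m) ⟩
      ((2 * (k + m)) C (2 * k)) * ((2 * k) ! * (2 * m) !)
        ≡⟨ cong (λ n → (n C (2 * k)) * ((2 * k) ! * (2 * m) !)) (*-distribˡ-+ 2 k m) ⟩
      ((2 * k + 2 * m) C (2 * k)) * ((2 * k) ! * (2 * m) !)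
        ≡⟨ [k+m]Ck*k!*m!≡[k+m]! (2 * k) (2 * m) ⟩
      (2 * k + 2 * m) !
        ≡⟨ cong _! (sym (*-distribˡ-+ 2 k m)) ⟩
      (2 * (k + m)) !
        ∎
    rhs : ((k + m) C k) * D (k + m) * (2 ^ (k + m) * (k ! * m !)) ≡ (2 * (k + m)) !
    rhs = begin
      ((k + m) C k) * D (k + m) * (2 ^ (k + m) * (k ! * m !))
        ≡⟨ regroup₂ ((k + m) C k) (D (k + m)) (2 ^ (k + m)) (k ! * m !) ⟩
      D (k + m) * (2 ^ (k + m) * (((k + m) C k) * (k ! * m !)))
        ≡⟨ cong (λ f → D (k + m) * (2 ^ (k + m) * f)) ([k+m]Ck*k!*m!≡[k+m]! k m) ⟩
      D (k + m) * (2 ^ (k + m) * (k + m) !)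
        ≡⟨ D[p]*2^p*p!≡[2p]! (k + m) ⟩
      (2 * (k + m)) !
        ∎

  C[2p,2k]*D[p∸k]≤C[p,k]*D[p] : ∀ {k p} → k ≤ p → ((2 * p) C (2 * k)) * D (p ∸ k) ≤ (p C k) * D p
  C[2p,2k]*D[p∸k]≤C[p,k]*D[p] {k} k≤p =
    subst (λ p → ((2 * p) C (2 * k)) * D (p ∸ k) ≤ (p C k) * D p) (m+[n∸m]≡n k≤p) (bound (_ ∸ k))
    where
    open ≤-Reasoning
    bound : ∀ m → ((2 * (k + m)) C (2 * k)) * D (k + m ∸ k) ≤ ((k + m) C k) * D (k + m)
    bound m = begin
      ((2 * (k + m)) C (2 * k)) * D (k + m ∸ k)  ≡⟨ cong (λ j → ((2 * (k + m)) C (2 * k)) * D j) (m+n∸m≡n k m) ⟩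
      ((2 * (k + m)) C (2 * k)) * D m            ≤⟨ m≤m*n _ (D k) {{D≢0 k}} ⟩
      ((2 * (k + m)) C (2 * k)) * D m * D k      ≡⟨ C[2p,2k]*D[p∸k]*D[k]≡C[p,k]*D[p] k m ⟩
      ((k + m) C k) * D (k + m)                  ∎

  C[2p+2,2]*D[p]≡[p+1]*D[p+1] : ∀ p → ((2 * suc p) C 2) * D p ≡ suc p * D (suc p)
  C[2p+2,2]*D[p]≡[p+1]*D[p+1] p = begin
    ((2 * suc p) C 2) * D p          ≡⟨ sym (*-identityʳ _) ⟩
    ((2 * suc p) C 2) * D p * D 1    ≡⟨ C[2p,2k]*D[p∸k]*D[k]≡C[p,k]*D[p] 1 p ⟩
    (suc p C 1) * D (suc p)          ≡⟨ cong (_* D (suc p)) (nC1≡n (suc p)) ⟩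
    suc p * D (suc p)                ∎
    where open ≡-Reasoning

module Khintchine where
  open import Data.Nat
  open import Data.Nat.Properties
  open import Data.Nat.Combinatorics using (_C_; nC1≡n; nCk+nC[k+1]≡[n+1]C[k+1])
  open import Data.Nat.Tactic.RingSolver using (solve-∀)
  open import Data.Fin using (zero; suc; toℕ)
  open import Data.Fin.Properties using (toℕ<n)
  open import Function using (_∘_)
  open import Relation.Binary.PropositionalEquality
  open import Algebra.Properties.Semiring.Sum +-*-semiring using (sum; sum-cong-≗; *-distribˡ-sum; sum⁺-syntax)
  open import Algebra.Definitions.RawSemiring +-*-rawSemiring using () renaming (_^_ to _^′_; _×_ to _×′_)
  import Algebra.Properties.CommutativeSemiring.Binomial +-*-commutativeSemiring as Binomial
  open Combinatorics

  binomialTheorem : ∀ n w s → (w + s) ^ n ≡ ∑[ k ≤ n ] ((n C toℕ k) * (w ^ toℕ k * s ^ (n ∸ toℕ k)))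
  binomialTheorem n w s = begin
    (w + s) ^ n                       ≡⟨ sym (^′≡^ (w + s) n) ⟩
    (w + s) ^′ n                      ≡⟨ Binomial.theorem n w s ⟩
    Binomial.binomialExpansion w s n  ≡⟨ sum-cong-≗ {suc n} term ⟩
    ∑[ k ≤ n ] ((n C toℕ k) * (w ^ toℕ k * s ^ (n ∸ toℕ k)))  ∎
    where
    open ≡-Reasoning
    ^′≡^ : ∀ x n → x ^′ n ≡ x ^ n
    ^′≡^ x zero    = refl
    ^′≡^ x (suc n) = cong (x *_) (^′≡^ x n)
    ×′≡* : ∀ n x → n ×′ x ≡ n * x
    ×′≡* zero    x = refl
    ×′≡* (suc n) x = cong (x +_) (×′≡* n x)
    term : ∀ k → Binomial.binomialTerm w s n k ≡ (n C toℕ k) * (w ^ toℕ k * s ^ (n ∸ toℕ k))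
    term k = trans (×′≡* (n C toℕ k) _)
                   (cong₂ (λ a b → (n C toℕ k) * (a * b)) (^′≡^ w (toℕ k)) (^′≡^ s (n ∸ toℕ k)))

  sum-mono-≤ : ∀ {n} {f g : Fin n → ℕ} → (∀ i → f i ≤ g i) → sum f ≤ sum g
  sum-mono-≤ {zero}  f≤g = z≤n
  sum-mono-≤ {suc n} f≤g = +-mono-≤ (f≤g zero) (sum-mono-≤ (f≤g ∘ suc))

  -- With xⱼ = cⱼ², this is Σ over b ∈ {±1}ⁿ of (Σⱼ bⱼ cⱼ)^(2p) (SignSums.sumSigns-evenPower):
  -- expand the power of ±c₀ + Σⱼ₊₁ bⱼ cⱼ, in which the odd powers of c₀ cancel.
  rademacherSum : (n : ℕ) → (Fin n → ℕ) → ℕ → ℕ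
  rademacherSum zero    x zero    = 1
  rademacherSum zero    x (suc p) = 0
  rademacherSum (suc n) x p =
    2 * ∑[ k ≤ p ] (((2 * p) C (2 * toℕ k)) * (x zero ^ toℕ k * rademacherSum n (x ∘ suc) (p ∸ toℕ k)))

  rademacherSum≤gaussian : ∀ n x p → rademacherSum n x p ≤ 2 ^ n * (D p * sum x ^ p)
  rademacherSum≤gaussian zero    x zero    = ≤-refl
  rademacherSum≤gaussian zero    x (suc p) = z≤n
  rademacherSum≤gaussian (suc n) x p = begin
    2 * ∑[ k ≤ p ] (c k * (w ^ toℕ k * rademacherSum n (x ∘ suc) (p ∸ toℕ k)))
      ≤⟨ *-monoʳ-≤ 2 (sum-mono-≤ {suc p} (λ k → *-monoʳ-≤ (c k) (*-monoʳ-≤ (w ^ toℕ k)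
           (rademacherSum≤gaussian n (x ∘ suc) (p ∸ toℕ k))))) ⟩
    2 * ∑[ k ≤ p ] (c k * (w ^ toℕ k * (2 ^ n * (D (p ∸ toℕ k) * s ^ (p ∸ toℕ k)))))
      ≡⟨ cong (2 *_) (trans (sum-cong-≗ {suc p} (λ k → regroup (c k) (w ^ toℕ k) (2 ^ n) (D (p ∸ toℕ k)) (s ^ (p ∸ toℕ k))))
                            (sym (*-distribˡ-sum (2 ^ n) (λ k → (c k * D (p ∸ toℕ k)) * b k)))) ⟩
    2 * (2 ^ n * ∑[ k ≤ p ] ((c k * D (p ∸ toℕ k)) * b k))
      ≤⟨ *-monoʳ-≤ 2 (*-monoʳ-≤ (2 ^ n) (sum-mono-≤ {suc p} (λ k → *-monoˡ-≤ (b k)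
           (C[2p,2k]*D[p∸k]≤C[p,k]*D[p] (≤-pred (toℕ<n k)))))) ⟩
    2 * (2 ^ n * ∑[ k ≤ p ] (((p C toℕ k) * D p) * b k))
      ≡⟨ cong (λ t → 2 * (2 ^ n * t)) (trans (sum-cong-≗ {suc p} (λ k → regroup′ (p C toℕ k) (D p) (b k)))
                                             (sym (*-distribˡ-sum (D p) (λ k → (p C toℕ k) * b k)))) ⟩
    2 * (2 ^ n * (D p * ∑[ k ≤ p ] ((p C toℕ k) * b k)))
      ≡⟨ cong (λ t → 2 * (2 ^ n * (D p * t))) (sym (binomialTheorem p w s)) ⟩
    2 * (2 ^ n * (D p * (w + s) ^ p))
      ≡⟨ sym (*-assoc 2 (2 ^ n) _) ⟩
    2 ^ suc n * (D p * (w + s) ^ p)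
      ∎
    where
    open ≤-Reasoning
    w = x zero
    s = sum (x ∘ suc)
    c : Fin (suc p) → ℕ
    c k = (2 * p) C (2 * toℕ k)
    b : Fin (suc p) → ℕ
    b k = w ^ toℕ k * s ^ (p ∸ toℕ k)
    regroup : ∀ c a t d b → c * (a * (t * (d * b))) ≡ t * ((c * d) * (a * b))
    regroup = solve-∀
    regroup′ : ∀ c d y → (c * d) * y ≡ d * (c * y)
    regroup′ = solve-∀

  rademacherSum-zero : ∀ n x → rademacherSum n x 0 ≡ 2 ^ n
  rademacherSum-zero zero    x = refl
  rademacherSum-zero (suc n) x =
    cong (2 *_) (trans (+-identityʳ _) (trans (*-identityˡ _) (trans (*-identityˡ _) (rademacherSum-zero n (x ∘ suc)))))

  rademacherSum≥firstTwoTerms : ∀ n x q →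
    2 * (rademacherSum n (x ∘ suc) (suc q) + ((2 * suc q) C 2) * (x zero * rademacherSum n (x ∘ suc) q))
      ≤ rademacherSum (suc n) x (suc q)
  rademacherSum≥firstTwoTerms n x q =
    *-monoʳ-≤ 2 (≤-trans (≤-reflexive (cong₂ _+_ term₀ term₁)) (+-monoʳ-≤ (term zero) (m≤m+n _ _)))
    where
    term : Fin (2 + q) → ℕ
    term k = ((2 * suc q) C (2 * toℕ k)) * (x zero ^ toℕ k * rademacherSum n (x ∘ suc) (suc q ∸ toℕ k))
    term₀ : rademacherSum n (x ∘ suc) (suc q) ≡ term zero
    term₀ = sym (trans (*-identityˡ _) (*-identityˡ _))
    term₁ : ((2 * suc q) C 2) * (x zero * rademacherSum n (x ∘ suc) q) ≡ term (suc zero)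
    term₁ = cong (λ v → ((2 * suc q) C 2) * (v * rademacherSum n (x ∘ suc) q)) (sym (*-identityʳ (x zero)))

  firstOrderTaylor≤ : ∀ r w s → s ^ suc r + w * s ^ r ≤ (w + s) ^ suc r
  firstOrderTaylor≤ r w s = begin
    s * s ^ r + w * s ^ r    ≡⟨ +-comm (s * s ^ r) _ ⟩
    w * s ^ r + s * s ^ r    ≡⟨ sym (*-distribʳ-+ (s ^ r) w s) ⟩
    (w + s) * s ^ r          ≤⟨ *-monoʳ-≤ (w + s) (^-monoˡ-≤ r (m≤n+m s w)) ⟩
    (w + s) * (w + s) ^ r    ∎
    where open ≤-Reasoning

  ≤secondOrderTaylor : ∀ q w s →
    (w + s) ^ (2 + q) ≤ s ^ (2 + q) + (2 + q) * (w * s ^ (1 + q)) + ((2 + q) C 2) * (w * w * (w + s) ^ q)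
  ≤secondOrderTaylor zero w s = ≤-reflexive (expand w s)
    where
    expand : ∀ w s → (w + s) * ((w + s) * 1) ≡ s * (s * 1) + 2 * (w * (s * 1)) + 1 * (w * w * 1)
    expand = solve-∀
  ≤secondOrderTaylor (suc q) w s = begin
    (w + s) * (w + s) ^ (2 + q)
      ≤⟨ *-monoʳ-≤ (w + s) (≤secondOrderTaylor q w s) ⟩
    (w + s) * (s ^ (2 + q) + (2 + q) * (w * s ^ (1 + q)) + c * (w * w * (w + s) ^ q))
      ≡⟨ expand w s (s ^ (1 + q)) ((w + s) ^ q) q c ⟩
    T + (2 + q) * (w * w * s ^ (1 + q)) + c * Y
      ≤⟨ +-monoˡ-≤ (c * Y) (+-monoʳ-≤ T (*-monoʳ-≤ (2 + q) (*-monoʳ-≤ (w * w) (^-monoˡ-≤ (1 + q) (m≤n+m s w))))) ⟩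
    T + (2 + q) * Y + c * Y
      ≡⟨ collect T Y (2 + q) c ⟩
    T + (2 + q + c) * Y
      ≡⟨ cong (λ m → T + m * Y) (trans (cong (_+ c) (sym (nC1≡n (2 + q)))) (nCk+nC[k+1]≡[n+1]C[k+1] (2 + q) 1)) ⟩
    T + ((3 + q) C 2) * Y
      ∎
    where
    open ≤-Reasoning
    c = (2 + q) C 2
    T = s ^ (3 + q) + (3 + q) * (w * s ^ (2 + q))
    Y = w * w * (w + s) ^ (1 + q)
    expand : ∀ w s S P q c → (w + s) * (s * S + (2 + q) * (w * S) + c * (w * w * P))
           ≡ s * (s * S) + (3 + q) * (w * (s * S)) + (2 + q) * (w * w * S) + c * (w * w * ((w + s) * P))
    expand = solve-∀
    collect : ∀ a Y m c → a + m * Y + c * Y ≡ a + (m + c) * Y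
    collect = solve-∀

  -- Chosen so that errorTerms≤K holds.
  K : ℕ → ℕ
  K 0 = 0
  K 1 = 0
  K (suc (suc q)) = D (2 + q) * ((2 + q) C 2) + ((2 * (2 + q)) C 2) * K (suc q)

  errorTerms≤K : ∀ r w s t →
    D (3 + r) * ((3 + r) C 2) * (w * w * (w + s) ^ (1 + r)) + K (3 + r) * (t * s ^ (1 + r))
      + ((2 * (3 + r)) C 2) * K (2 + r) * (t * (w * s ^ r))
    ≤ K (3 + r) * ((w * w + t) * (w + s) ^ (1 + r))
  errorTerms≤K r w s t = begin
    Dc * Y + k * (t * s ^ (1 + r)) + bK * (t * (w * s ^ r))
      ≤⟨ +-mono-≤ (+-monoˡ-≤ _ (*-monoˡ-≤ Y (m≤m+n Dc bK))) (*-monoˡ-≤ (t * (w * s ^ r)) (m≤n+m bK Dc)) ⟩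
    k * Y + k * (t * s ^ (1 + r)) + k * (t * (w * s ^ r))
      ≡⟨ factor k Y t (s ^ (1 + r)) (w * s ^ r) ⟩
    k * Y + k * (t * (s ^ (1 + r) + w * s ^ r))
      ≤⟨ +-monoʳ-≤ (k * Y) (*-monoʳ-≤ k (*-monoʳ-≤ t (firstOrderTaylor≤ r w s))) ⟩
    k * Y + k * (t * (w + s) ^ (1 + r))
      ≡⟨ factor′ k (w * w) t ((w + s) ^ (1 + r)) ⟩
    k * ((w * w + t) * (w + s) ^ (1 + r))
      ∎
    where
    open ≤-Reasoning
    k = K (3 + r)
    Dc = D (3 + r) * ((3 + r) C 2)
    bK = ((2 * (3 + r)) C 2) * K (2 + r)
    Y = w * w * (w + s) ^ (1 + r)
    factor : ∀ k Y t S₁ S₀ → k * Y + k * (t * S₁) + k * (t * S₀) ≡ k * Y + k * (t * (S₁ + S₀))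
    factor = solve-∀
    factor′ : ∀ k v t P → k * (v * P) + k * (t * P) ≡ k * ((v + t) * P)
    factor′ = solve-∀

  -- The inductive step of the lower bound below, with every error term moved to the
  -- side where it is added, so that no subtraction occurs.
  gaussianStep : ∀ q w s t →
    D (suc q) * (w + s) ^ suc q + K (suc q) * (t * s ^ (suc q ∸ 2)) + ((2 * suc q) C 2) * (w * (K q * (t * s ^ (q ∸ 2))))
      ≤ D (suc q) * s ^ suc q + ((2 * suc q) C 2) * (D q * (w * s ^ q)) + K (suc q) * ((w * w + t) * (w + s) ^ (suc q ∸ 2))
  gaussianStep 0 w s t = ≤-reflexive (identity w s)
    where
    identity : ∀ w s → 1 * ((w + s) * 1) + 0 + 1 * (w * 0) ≡ 1 * (s * 1) + 1 * (1 * (w * 1)) + 0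
    identity = solve-∀
  gaussianStep 1 w s t = ≤-reflexive (identity w s t)
    where
    identity : ∀ w s t → 3 * ((w + s) * ((w + s) * 1)) + 3 * (t * 1) + 6 * (w * 0)
                       ≡ 3 * (s * (s * 1)) + 6 * (1 * (w * (s * 1))) + 3 * ((w * w + t) * 1)
    identity = solve-∀
  gaussianStep (suc (suc r)) w s t = begin
    Dp * (w + s) ^ p + e₁ + b * (w * (K (2 + r) * (t * s ^ r)))
      ≤⟨ +-monoˡ-≤ _ (+-monoˡ-≤ e₁ (*-monoʳ-≤ Dp (≤secondOrderTaylor (suc r) w s))) ⟩
    Dp * (s ^ p + p * X + (p C 2) * (w * w * P)) + e₁ + b * (w * (K (2 + r) * (t * s ^ r)))
      ≡⟨ regroup Dp (s ^ p) p X (p C 2) (w * w * P) e₁ b w (K (2 + r)) t (s ^ r) ⟩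
    Dp * s ^ p + (p * Dp) * X + (Dp * (p C 2) * (w * w * P) + e₁ + b * K (2 + r) * (t * (w * s ^ r)))
      ≤⟨ +-monoʳ-≤ _ (errorTerms≤K r w s t) ⟩
    Dp * s ^ p + (p * Dp) * X + K p * ((w * w + t) * P)
      ≡⟨ cong (λ m → Dp * s ^ p + m * X + K p * ((w * w + t) * P)) (sym (C[2p+2,2]*D[p]≡[p+1]*D[p+1] (2 + r))) ⟩
    Dp * s ^ p + (b * D (2 + r)) * X + K p * ((w * w + t) * P)
      ≡⟨ cong (λ y → Dp * s ^ p + y + K p * ((w * w + t) * P)) (*-assoc b (D (2 + r)) X) ⟩
    Dp * s ^ p + b * (D (2 + r) * X) + K p * ((w * w + t) * P)
      ∎
    where
    open ≤-Reasoning
    p = 3 + r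
    Dp = D p
    b = (2 * p) C 2
    e₁ = K p * (t * s ^ (1 + r))
    P = (w + s) ^ (1 + r)
    X = w * s ^ (2 + r)
    regroup : ∀ Dp sp p X c Y e b w k t S →
      Dp * (sp + p * X + c * Y) + e + b * (w * (k * (t * S)))
      ≡ Dp * sp + (p * Dp) * X + (Dp * c * Y + e + b * k * (t * (w * S)))
    regroup = solve-∀

  gaussian≤rademacherSum+error : ∀ n x p →
    D p * (2 ^ n * sum x ^ p) ≤ rademacherSum n x p + 2 ^ n * (K p * (sum (λ j → x j * x j) * sum x ^ (p ∸ 2)))
  gaussian≤rademacherSum+error n x zero = begin
    1 * (2 ^ n * 1)            ≡⟨ trans (*-identityˡ _) (trans (*-identityʳ _) (sym (rademacherSum-zero n x))) ⟩
    rademacherSum n x 0        ≤⟨ m≤m+n _ _ ⟩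
    rademacherSum n x 0 + _    ∎
    where open ≤-Reasoning
  gaussian≤rademacherSum+error zero x (suc p) = ≤-trans (≤-reflexive (*-zeroʳ (D (suc p)))) z≤n
  -- The errors of the two induction hypotheses (extra) are added to both sides and cancelled.
  gaussian≤rademacherSum+error (suc n) x (suc q) = +-cancelʳ-≤ extra _ _ (begin
    Dp * (2 * a * (w + s) ^ p) + extra
      ≡⟨ regroup₁ Dp a ((w + s) ^ p) e₁ b w e₂ ⟩
    2 * a * (Dp * (w + s) ^ p + e₁ + b * (w * e₂))
      ≤⟨ *-monoʳ-≤ (2 * a) (gaussianStep q w s t) ⟩
    2 * a * (Dp * s ^ p + b * (D q * (w * s ^ q)) + E)
      ≡⟨ regroup₂ a Dp (s ^ p) b (D q) w (s ^ q) E ⟩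
    2 * (Dp * (a * s ^ p)) + 2 * (b * (w * (D q * (a * s ^ q)))) + 2 * a * E
      ≤⟨ +-monoˡ-≤ (2 * a * E) (+-mono-≤ (*-monoʳ-≤ 2 (gaussian≤rademacherSum+error n x′ p))
                                         (*-monoʳ-≤ 2 (*-monoʳ-≤ b (*-monoʳ-≤ w (gaussian≤rademacherSum+error n x′ q))))) ⟩
    2 * (Rp + a * e₁) + 2 * (b * (w * (Rq + a * e₂))) + 2 * a * E
      ≡⟨ regroup₃ Rp a e₁ b w Rq e₂ E ⟩
    2 * (Rp + b * (w * Rq)) + 2 * a * E + extra
      ≤⟨ +-monoˡ-≤ extra (+-monoˡ-≤ (2 * a * E) (rademacherSum≥firstTwoTerms n x q)) ⟩
    rademacherSum (suc n) x p + 2 * a * E + extra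
      ∎)
    where
    open ≤-Reasoning
    p = suc q
    x′ = x ∘ suc
    w = x zero
    s = sum x′
    t = sum (λ j → x′ j * x′ j)
    a = 2 ^ n
    Dp = D p
    b = (2 * p) C 2
    Rp = rademacherSum n x′ p
    Rq = rademacherSum n x′ q
    e₁ = K p * (t * s ^ (p ∸ 2))
    e₂ = K q * (t * s ^ (q ∸ 2))
    E = K p * ((w * w + t) * (w + s) ^ (p ∸ 2))
    extra = 2 * (a * e₁) + 2 * (b * (w * (a * e₂)))
    regroup₁ : ∀ d a P e₁ b w e₂ →
      d * (2 * a * P) + (2 * (a * e₁) + 2 * (b * (w * (a * e₂)))) ≡ 2 * a * (d * P + e₁ + b * (w * e₂))
    regroup₁ = solve-∀
    regroup₂ : ∀ a d S b d′ w S′ E →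
      2 * a * (d * S + b * (d′ * (w * S′)) + E) ≡ 2 * (d * (a * S)) + 2 * (b * (w * (d′ * (a * S′)))) + 2 * a * E
    regroup₂ = solve-∀
    regroup₃ : ∀ R a e₁ b w R′ e₂ E →
      2 * (R + a * e₁) + 2 * (b * (w * (R′ + a * e₂))) + 2 * a * E
      ≡ 2 * (R + b * (w * R′)) + 2 * a * E + (2 * (a * e₁) + 2 * (b * (w * (a * e₂))))
    regroup₃ = solve-∀

  K*s^[p∸2]*s²≡K*s^p : ∀ p s → K p * (s ^ (p ∸ 2) * (s * s)) ≡ K p * s ^ p
  K*s^[p∸2]*s²≡K*s^p 0 s = refl
  K*s^[p∸2]*s²≡K*s^p 1 s = refl
  K*s^[p∸2]*s²≡K*s^p (suc (suc r)) s = cong (K (2 + r) *_) (regroup (s ^ r) s)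
    where
    regroup : ∀ t s → t * (s * s) ≡ s * (s * t)
    regroup = solve-∀

module IntegerSums where
  open import Data.Nat as ℕ using (zero; suc)
  import Data.Nat.Properties as ℕ
  open import Data.Nat.Combinatorics using (_C_)
  open import Data.Integer hiding (suc)
  open import Data.Integer.Properties
  open import Data.Integer.Tactic.RingSolver using (solve-∀)
  open import Data.Fin using (zero; suc; toℕ; punchIn)
  open import Data.Fin.Properties using (punchInᵢ≢i)
  open import Function using (_∘_)
  open import Relation.Binary.PropositionalEquality
  open import Algebra.Properties.Semiring.Sum +-*-semiring
    using (sum; sum-cong-≗; *-distribˡ-sum; *-distribʳ-sum; ∑-distrib-+; sum-syntax; sum⁺-syntax;
           sum-replicate; sum-replicate-zero; sum-remove)
  import Algebra.Properties.Semiring.Sum ℕ.+-*-semiring as ℕΣ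
  open import Algebra.Definitions.RawSemiring +-*-rawSemiring using () renaming (_^_ to _^′_; _×_ to _×′_)
  import Algebra.Properties.CommutativeSemiring.Binomial +-*-commutativeSemiring as Binomial
  open Khintchine using (rademacherSum)

  sumFin≡sum : ∀ n (f : Fin n → ℤ) → sumFin n f ≡ sum f
  sumFin≡sum zero    f = refl
  sumFin≡sum (suc n) f = cong (λ s → f zero + s) (sumFin≡sum n (f ∘ suc))

  ×≡* : ∀ n x → n ×′ x ≡ + n * x
  ×≡* zero    x = refl
  ×≡* (suc n) x = trans (cong (λ t → x + t) (×≡* n x))
                        (sym (trans (*-distribʳ-+ x (+ 1) (+ n)) (cong (_+ + n * x) (*-identityˡ x))))

  sum-const : ∀ n z → ∑[ i < n ] z ≡ + n * z
  sum-const n z = trans (sum-replicate n) (×≡* n z)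

  sum-mono-≤ : ∀ {n} {f g : Fin n → ℤ} → (∀ i → f i ≤ g i) → sum f ≤ sum g
  sum-mono-≤ {zero}  f≤g = ≤-refl
  sum-mono-≤ {suc n} f≤g = +-mono-≤ (f≤g zero) (sum-mono-≤ (f≤g ∘ suc))

  sum*sum : ∀ {m n} (f : Fin m → ℤ) (g : Fin n → ℤ) → sum f * sum g ≡ ∑[ i < m ] ∑[ j < n ] (f i * g j)
  sum*sum {m} f g = trans (*-distribʳ-sum (sum g) f) (sum-cong-≗ {m} (λ i → *-distribˡ-sum (f i) g))

  sum-δ : ∀ {n} (t : Fin n → ℤ) i → (∀ j → j ≢ i → t j ≡ 0ℤ) → sum t ≡ t i
  sum-δ {suc n} t i t≡0 = begin
    sum t                        ≡⟨ sum-remove {i = i} t ⟩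
    t i + sum (t ∘ punchIn i)    ≡⟨ cong (λ s → t i + s) (trans (sum-cong-≗ {n} (λ j → t≡0 (punchIn i j) (punchInᵢ≢i i j)))
                                                               (sum-replicate-zero n)) ⟩
    t i + 0ℤ                     ≡⟨ +-identityʳ (t i) ⟩
    t i                          ∎
    where open ≡-Reasoning

  binomialTheorem : ∀ n x y → (x + y) ^ n ≡ ∑[ k ≤ n ] (+ (n C toℕ k) * (x ^ toℕ k * y ^ (n ℕ.∸ toℕ k)))
  binomialTheorem n x y = begin
    (x + y) ^ n                       ≡⟨ sym (^′≡^ (x + y) n) ⟩
    (x + y) ^′ n                      ≡⟨ Binomial.theorem n x y ⟩
    Binomial.binomialExpansion x y n  ≡⟨ sum-cong-≗ {suc n} term ⟩
    ∑[ k ≤ n ] (+ (n C toℕ k) * (x ^ toℕ k * y ^ (n ℕ.∸ toℕ k)))  ∎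
    where
    open ≡-Reasoning
    ^′≡^ : ∀ x n → x ^′ n ≡ x ^ n
    ^′≡^ x zero    = refl
    ^′≡^ x (suc n) = cong (x *_) (^′≡^ x n)
    term : ∀ k → Binomial.binomialTerm x y n k ≡ + (n C toℕ k) * (x ^ toℕ k * y ^ (n ℕ.∸ toℕ k))
    term k = trans (×≡* (n C toℕ k) _)
                   (cong₂ (λ a b → + (n C toℕ k) * (a * b)) (^′≡^ x (toℕ k)) (^′≡^ y (n ℕ.∸ toℕ k)))

  sum-parity : ∀ p (g : ℕ → ℤ) →
    ∑[ k < suc (2 ℕ.* p) ] g (toℕ k) ≡ ∑[ k < suc p ] g (2 ℕ.* toℕ k) + ∑[ k < p ] g (suc (2 ℕ.* toℕ k))
  sum-parity zero    g = sym (+-identityʳ _)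
  sum-parity (suc p) g = begin
    ∑[ k < suc (2 ℕ.* suc p) ] g (toℕ k)
      ≡⟨ cong (λ m → ∑[ k < suc m ] g (toℕ k)) (ℕ.*-suc 2 p) ⟩
    g 0 + (g 1 + ∑[ k < suc (2 ℕ.* p) ] g (2 ℕ.+ toℕ k))
      ≡⟨ cong (λ t → g 0 + (g 1 + t)) (sum-parity p (g ∘ (2 ℕ.+_))) ⟩
    g 0 + (g 1 + (∑[ k < suc p ] g (2 ℕ.+ 2 ℕ.* toℕ k) + ∑[ k < p ] g (2 ℕ.+ suc (2 ℕ.* toℕ k))))
      ≡⟨ regroup (g 0) (g 1) _ _ ⟩
    g 0 + ∑[ k < suc p ] g (2 ℕ.+ 2 ℕ.* toℕ k) + (g 1 + ∑[ k < p ] g (2 ℕ.+ suc (2 ℕ.* toℕ k)))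
      ≡⟨ cong₂ (λ e o → g 0 + e + (g 1 + o)) (sum-cong-≗ {suc p} (λ k → cong g (sym (ℕ.*-suc 2 (toℕ k)))))
                                             (sum-cong-≗ {p} (λ k → cong (g ∘ suc) (sym (ℕ.*-suc 2 (toℕ k))))) ⟩
    ∑[ k < suc (suc p) ] g (2 ℕ.* toℕ k) + ∑[ k < suc p ] g (suc (2 ℕ.* toℕ k))
      ∎
    where
    open ≡-Reasoning
    regroup : ∀ a b c d → a + (b + (c + d)) ≡ a + c + (b + d)
    regroup = solve-∀

  [-x]^[2k]≡x^[2k] : ∀ x k → (- x) ^ (2 ℕ.* k) ≡ x ^ (2 ℕ.* k)
  [-x]^[2k]≡x^[2k] x k = begin
    (- x) ^ (2 ℕ.* k)    ≡⟨ sym (^-*-assoc (- x) 2 k) ⟩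
    ((- x) ^ 2) ^ k      ≡⟨ cong (_^ k) (square x) ⟩
    (x ^ 2) ^ k          ≡⟨ ^-*-assoc x 2 k ⟩
    x ^ (2 ℕ.* k)        ∎
    where
    open ≡-Reasoning
    square : ∀ x → - x * (- x * + 1) ≡ x * (x * + 1)
    square = solve-∀

  x^[2k]≡[x*x]^k : ∀ x k → x ^ (2 ℕ.* k) ≡ (x * x) ^ k
  x^[2k]≡[x*x]^k x k = trans (sym (^-*-assoc x 2 k)) (cong (_^ k) (cong (x *_) (*-identityʳ x)))

  evenBinomial : ∀ p x y →
    (x + y) ^ (2 ℕ.* p) + (- x + y) ^ (2 ℕ.* p)
      ≡ ∑[ k ≤ p ] (+ 2 * + ((2 ℕ.* p) C (2 ℕ.* toℕ k)) * (x * x) ^ toℕ k * y ^ (2 ℕ.* (p ℕ.∸ toℕ k)))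
  evenBinomial p x y = begin
    (x + y) ^ (2 ℕ.* p) + (- x + y) ^ (2 ℕ.* p)
      ≡⟨ cong₂ _+_ (binomialTheorem (2 ℕ.* p) x y) (binomialTheorem (2 ℕ.* p) (- x) y) ⟩
    ∑[ k < suc (2 ℕ.* p) ] term x (toℕ k) + ∑[ k < suc (2 ℕ.* p) ] term (- x) (toℕ k)
      ≡⟨ sym (∑-distrib-+ {suc (2 ℕ.* p)} (term x ∘ toℕ) (term (- x) ∘ toℕ)) ⟩
    ∑[ k < suc (2 ℕ.* p) ] g (toℕ k)
      ≡⟨ sum-parity p g ⟩
    ∑[ k < suc p ] g (2 ℕ.* toℕ k) + ∑[ k < p ] g (suc (2 ℕ.* toℕ k))
      ≡⟨ cong₂ _+_ (sum-cong-≗ {suc p} (even ∘ toℕ)) (trans (sum-cong-≗ {p} (odd ∘ toℕ)) (sum-replicate-zero p)) ⟩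
    evens + 0ℤ
      ≡⟨ +-identityʳ evens ⟩
    evens
      ∎
    where
    open ≡-Reasoning
    term : ℤ → ℕ → ℤ
    term z k = + ((2 ℕ.* p) C k) * (z ^ k * y ^ (2 ℕ.* p ℕ.∸ k))
    g : ℕ → ℤ
    g k = term x k + term (- x) k
    evens : ℤ
    evens = ∑[ k ≤ p ] (+ 2 * + ((2 ℕ.* p) C (2 ℕ.* toℕ k)) * (x * x) ^ toℕ k * y ^ (2 ℕ.* (p ℕ.∸ toℕ k)))
    doubled : ∀ c a b → c * (a * b) + c * (a * b) ≡ + 2 * c * a * b
    doubled = solve-∀
    cancels : ∀ c x X Y → c * (x * X * Y) + c * (- x * X * Y) ≡ 0ℤ
    cancels = solve-∀
    even : ∀ k → g (2 ℕ.* k) ≡ + 2 * + ((2 ℕ.* p) C (2 ℕ.* k)) * (x * x) ^ k * y ^ (2 ℕ.* (p ℕ.∸ k))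
    even k = begin
      term x (2 ℕ.* k) + term (- x) (2 ℕ.* k)
        ≡⟨ cong (λ t → term x (2 ℕ.* k) + + ((2 ℕ.* p) C (2 ℕ.* k)) * (t * y ^ (2 ℕ.* p ℕ.∸ 2 ℕ.* k))) ([-x]^[2k]≡x^[2k] x k) ⟩
      term x (2 ℕ.* k) + term x (2 ℕ.* k)
        ≡⟨ doubled (+ ((2 ℕ.* p) C (2 ℕ.* k))) (x ^ (2 ℕ.* k)) (y ^ (2 ℕ.* p ℕ.∸ 2 ℕ.* k)) ⟩
      + 2 * + ((2 ℕ.* p) C (2 ℕ.* k)) * x ^ (2 ℕ.* k) * y ^ (2 ℕ.* p ℕ.∸ 2 ℕ.* k)
        ≡⟨ cong₂ (λ a b → + 2 * + ((2 ℕ.* p) C (2 ℕ.* k)) * a * y ^ b) (x^[2k]≡[x*x]^k x k) (sym (ℕ.*-distribˡ-∸ 2 p k)) ⟩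
      + 2 * + ((2 ℕ.* p) C (2 ℕ.* k)) * (x * x) ^ k * y ^ (2 ℕ.* (p ℕ.∸ k))
        ∎
    odd : ∀ k → g (suc (2 ℕ.* k)) ≡ 0ℤ
    odd k = trans (cong (λ t → term x (suc (2 ℕ.* k)) + + ((2 ℕ.* p) C suc (2 ℕ.* k)) * (- x * t * y ^ (2 ℕ.* p ℕ.∸ suc (2 ℕ.* k))))
                        ([-x]^[2k]≡x^[2k] x k))
                  (cancels (+ ((2 ℕ.* p) C suc (2 ℕ.* k))) x (x ^ (2 ℕ.* k)) (y ^ (2 ℕ.* p ℕ.∸ suc (2 ℕ.* k))))

  pos-^ : ∀ m n → + (m ℕ.^ n) ≡ (+ m) ^ n
  pos-^ m zero    = refl
  pos-^ m (suc n) = trans (pos-* m (m ℕ.^ n)) (cong (+ m *_) (pos-^ m n))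

  pos-sum : ∀ {n} (f : Fin n → ℕ) → + (ℕΣ.sum f) ≡ ∑[ j < n ] (+ f j)
  pos-sum {zero}  f = refl
  pos-sum {suc n} f = trans (pos-+ (f zero) _) (cong (λ t → + f zero + t) (pos-sum (f ∘ suc)))

  +∣i∣*∣i∣≡i*i : ∀ i → + (∣ i ∣ ℕ.* ∣ i ∣) ≡ i * i
  +∣i∣*∣i∣≡i*i (+ n)    = pos-* n n
  +∣i∣*∣i∣≡i*i -[1+ n ] = pos-* (suc n) (suc n)

  +rademacherSum-suc : ∀ n (x : Fin (suc n) → ℕ) p →
    + rademacherSum (suc n) x p
      ≡ ∑[ k ≤ p ] (+ 2 * + ((2 ℕ.* p) C (2 ℕ.* toℕ k)) * (+ x zero) ^ toℕ k * + rademacherSum n (x ∘ suc) (p ℕ.∸ toℕ k))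
  +rademacherSum-suc n x p = begin
    + (2 ℕ.* ℕΣ.sum {suc p} (f ∘ toℕ))  ≡⟨ pos-* 2 (ℕΣ.sum {suc p} (f ∘ toℕ)) ⟩
    + 2 * + ℕΣ.sum {suc p} (f ∘ toℕ)    ≡⟨ cong (+ 2 *_) (pos-sum {suc p} (f ∘ toℕ)) ⟩
    + 2 * ∑[ k ≤ p ] (+ f (toℕ k))      ≡⟨ *-distribˡ-sum {suc p} (+ 2) (+_ ∘ f ∘ toℕ) ⟩
    ∑[ k ≤ p ] (+ 2 * + f (toℕ k))      ≡⟨ sum-cong-≗ {suc p} (term ∘ toℕ) ⟩
    ∑[ k ≤ p ] (+ 2 * + c (toℕ k) * (+ x zero) ^ toℕ k * + R (toℕ k))  ∎
    where
    open ≡-Reasoning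
    c : ℕ → ℕ
    c k = (2 ℕ.* p) C (2 ℕ.* k)
    R : ℕ → ℕ
    R k = rademacherSum n (x ∘ suc) (p ℕ.∸ k)
    f : ℕ → ℕ
    f k = c k ℕ.* (x zero ℕ.^ k ℕ.* R k)
    regroup : ∀ c w r → + 2 * (c * (w * r)) ≡ + 2 * c * w * r
    regroup = solve-∀
    term : ∀ k → + 2 * + f k ≡ + 2 * + c k * (+ x zero) ^ k * + R k
    term k = begin
      + 2 * + (c k ℕ.* (x zero ℕ.^ k ℕ.* R k))     ≡⟨ cong (+ 2 *_) (pos-* (c k) _) ⟩
      + 2 * (+ c k * + (x zero ℕ.^ k ℕ.* R k))     ≡⟨ cong (λ t → + 2 * (+ c k * t)) (pos-* (x zero ℕ.^ k) (R k)) ⟩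
      + 2 * (+ c k * (+ (x zero ℕ.^ k) * + R k))   ≡⟨ cong (λ t → + 2 * (+ c k * (t * + R k))) (pos-^ (x zero) k) ⟩
      + 2 * (+ c k * ((+ x zero) ^ k * + R k))     ≡⟨ regroup (+ c k) ((+ x zero) ^ k) (+ R k) ⟩
      + 2 * + c k * (+ x zero) ^ k * + R k         ∎

module SignSums where
  open import Data.Nat as ℕ using (zero; suc)
  import Data.Nat.Properties as ℕ
  open import Data.Nat.Combinatorics using (_C_)
  open import Data.Integer hiding (suc)
  open import Data.Integer.Properties
  open import Data.Fin using (zero; suc; toℕ)
  open import Data.Sum using (inj₁; inj₂)
  open import Function using (_∘_)
  open import Relation.Binary.PropositionalEquality
  open import Algebra.Properties.Semiring.Sum +-*-semiring using (sum; sum-cong-≗; sum-syntax; sum⁺-syntax)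
  open import Algebra.Properties.CommutativeSemigroup +-commutativeSemigroup using (interchange)
  import Algebra.Properties.Semiring.Sum ℕ.+-*-semiring as ℕΣ
  open Khintchine using (rademacherSum)
  open IntegerSums

  IsSignVector : ∀ {n} → (Fin n → ℤ) → Set
  IsSignVector b = ∀ i → IsSign (b i)

  cons-isSignVector : ∀ {n σ} {b : Fin n → ℤ} → IsSign σ → IsSignVector b → IsSignVector (cons σ b)
  cons-isSignVector σ± b± zero    = σ±
  cons-isSignVector σ± b± (suc i) = b± i

  sign*sign≡1 : ∀ {z} → IsSign z → z * z ≡ + 1
  sign*sign≡1 (inj₁ refl) = refl
  sign*sign≡1 (inj₂ refl) = refl

  ∑∣sign∣²≡n : ∀ {n} (c : Fin n → ℤ) → IsSignVector c → ℕΣ.sum (λ i → ∣ c i ∣ ℕ.* ∣ c i ∣) ≡ n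
  ∑∣sign∣²≡n {n} c c± = +-injective (begin
    + ℕΣ.sum (λ i → ∣ c i ∣ ℕ.* ∣ c i ∣)   ≡⟨ pos-sum (λ i → ∣ c i ∣ ℕ.* ∣ c i ∣) ⟩
    ∑[ i < n ] (+ (∣ c i ∣ ℕ.* ∣ c i ∣))   ≡⟨ sum-cong-≗ {n} (λ i → trans (+∣i∣*∣i∣≡i*i (c i)) (sign*sign≡1 (c± i))) ⟩
    ∑[ i < n ] (+ 1)                        ≡⟨ sum-const n (+ 1) ⟩
    + n * + 1                               ≡⟨ *-identityʳ (+ n) ⟩
    + n                                     ∎)
    where open ≡-Reasoning

  sumSigns : (n : ℕ) → ((Fin n → ℤ) → ℤ) → ℤ
  sumSigns zero    g = g (λ ())
  sumSigns (suc n) g = sumSigns n (g ∘ cons (+ 1)) + sumSigns n (g ∘ cons -1ℤ)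

  sumSigns-mono-≤ : ∀ n {f g : (Fin n → ℤ) → ℤ} → (∀ b → IsSignVector b → f b ≤ g b) → sumSigns n f ≤ sumSigns n g
  sumSigns-mono-≤ zero    f≤g = f≤g _ (λ ())
  sumSigns-mono-≤ (suc n) f≤g = +-mono-≤ (sumSigns-mono-≤ n (λ b b± → f≤g _ (cons-isSignVector (inj₁ refl) b±)))
                                         (sumSigns-mono-≤ n (λ b b± → f≤g _ (cons-isSignVector (inj₂ refl) b±)))

  sumSigns-cong : ∀ n {f g : (Fin n → ℤ) → ℤ} → (∀ b → IsSignVector b → f b ≡ g b) → sumSigns n f ≡ sumSigns n g
  sumSigns-cong n f≡g = ≤-antisym (sumSigns-mono-≤ n (λ b b± → ≤-reflexive (f≡g b b±)))
                                  (sumSigns-mono-≤ n (λ b b± → ≤-reflexive (sym (f≡g b b±))))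

  sumSigns-+ : ∀ n (f g : (Fin n → ℤ) → ℤ) → sumSigns n (λ b → f b + g b) ≡ sumSigns n f + sumSigns n g
  sumSigns-+ zero    f g = refl
  sumSigns-+ (suc n) f g =
    trans (cong₂ _+_ (sumSigns-+ n (f ∘ cons (+ 1)) (g ∘ cons (+ 1))) (sumSigns-+ n (f ∘ cons -1ℤ) (g ∘ cons -1ℤ)))
          (interchange (sumSigns n (f ∘ cons (+ 1))) _ _ _)

  sumSigns-*ˡ : ∀ n c (f : (Fin n → ℤ) → ℤ) → sumSigns n (λ b → c * f b) ≡ c * sumSigns n f
  sumSigns-*ˡ zero    c f = refl
  sumSigns-*ˡ (suc n) c f = trans (cong₂ _+_ (sumSigns-*ˡ n c _) (sumSigns-*ˡ n c _)) (sym (*-distribˡ-+ c _ _))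

  sumSigns-const : ∀ n z → sumSigns n (λ _ → z) ≡ + (2 ℕ.^ n) * z
  sumSigns-const zero    z = sym (*-identityˡ z)
  sumSigns-const (suc n) z = begin
    sumSigns n (λ _ → z) + sumSigns n (λ _ → z)   ≡⟨ cong₂ _+_ (sumSigns-const n z) (sumSigns-const n z) ⟩
    + (2 ℕ.^ n) * z + + (2 ℕ.^ n) * z             ≡⟨ sym (*-distribʳ-+ z (+ (2 ℕ.^ n)) (+ (2 ℕ.^ n))) ⟩
    + (2 ℕ.^ n ℕ.+ 2 ℕ.^ n) * z                   ≡⟨ cong (λ m → + (2 ℕ.^ n ℕ.+ m) * z) (sym (ℕ.+-identityʳ (2 ℕ.^ n))) ⟩
    + (2 ℕ.^ suc n) * z                           ∎
    where open ≡-Reasoning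

  sumSigns-sum : ∀ n {m} (F : Fin m → (Fin n → ℤ) → ℤ) →
    sumSigns n (λ b → ∑[ j < m ] F j b) ≡ ∑[ j < m ] sumSigns n (F j)
  sumSigns-sum n {zero}  F = trans (sumSigns-const n 0ℤ) (*-zeroʳ (+ (2 ℕ.^ n)))
  sumSigns-sum n {suc m} F = trans (sumSigns-+ n (F zero) (λ b → ∑[ j < m ] F (suc j) b))
                                   (cong (λ t → sumSigns n (F zero) + t) (sumSigns-sum n (F ∘ suc)))

  sumSigns-evenPower : ∀ n (c : Fin n → ℤ) p →
    sumSigns n (λ b → (∑[ j < n ] (b j * c j)) ^ (2 ℕ.* p)) ≡ + rademacherSum n (λ j → ∣ c j ∣ ℕ.* ∣ c j ∣) p
  sumSigns-evenPower zero    c zero    = refl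
  sumSigns-evenPower zero    c (suc p) = refl
  sumSigns-evenPower (suc n) c p = begin
    sumSigns n (λ b → (+ 1 * c₀ + L b) ^ (2 ℕ.* p)) + sumSigns n (λ b → (-1ℤ * c₀ + L b) ^ (2 ℕ.* p))
      ≡⟨ cong₂ _+_ (sumSigns-cong n (λ b _ → cong (λ a → (a + L b) ^ (2 ℕ.* p)) (*-identityˡ c₀)))
                   (sumSigns-cong n (λ b _ → cong (λ a → (a + L b) ^ (2 ℕ.* p)) (-1*i≡-i c₀))) ⟩
    sumSigns n (λ b → (c₀ + L b) ^ (2 ℕ.* p)) + sumSigns n (λ b → (- c₀ + L b) ^ (2 ℕ.* p))
      ≡⟨ sym (sumSigns-+ n (λ b → (c₀ + L b) ^ (2 ℕ.* p)) (λ b → (- c₀ + L b) ^ (2 ℕ.* p))) ⟩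
    sumSigns n (λ b → (c₀ + L b) ^ (2 ℕ.* p) + (- c₀ + L b) ^ (2 ℕ.* p))
      ≡⟨ sumSigns-cong n (λ b _ → evenBinomial p c₀ (L b)) ⟩
    sumSigns n (λ b → ∑[ k ≤ p ] (a (toℕ k) * L b ^ (2 ℕ.* (p ℕ.∸ toℕ k))))
      ≡⟨ sumSigns-sum n {suc p} (λ k b → a (toℕ k) * L b ^ (2 ℕ.* (p ℕ.∸ toℕ k))) ⟩
    ∑[ k ≤ p ] sumSigns n (λ b → a (toℕ k) * L b ^ (2 ℕ.* (p ℕ.∸ toℕ k)))
      ≡⟨ sum-cong-≗ {suc p} (λ k → trans (sumSigns-*ˡ n (a (toℕ k)) _)
                                         (cong (a (toℕ k) *_) (sumSigns-evenPower n (c ∘ suc) (p ℕ.∸ toℕ k)))) ⟩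
    ∑[ k ≤ p ] (a (toℕ k) * + rademacherSum n (x ∘ suc) (p ℕ.∸ toℕ k))
      ≡⟨ sum-cong-≗ {suc p} (λ k → cong (λ z → + 2 * + ((2 ℕ.* p) C (2 ℕ.* toℕ k)) * z ^ toℕ k * + rademacherSum n (x ∘ suc) (p ℕ.∸ toℕ k))
                                          (sym (+∣i∣*∣i∣≡i*i c₀))) ⟩
    ∑[ k ≤ p ] (+ 2 * + ((2 ℕ.* p) C (2 ℕ.* toℕ k)) * (+ x zero) ^ toℕ k * + rademacherSum n (x ∘ suc) (p ℕ.∸ toℕ k))
      ≡⟨ sym (+rademacherSum-suc n x p) ⟩
    + rademacherSum (suc n) x p
      ∎
    where
    open ≡-Reasoning
    c₀ = c zero
    x : Fin (suc n) → ℕ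
    x j = ∣ c j ∣ ℕ.* ∣ c j ∣
    L : (Fin n → ℤ) → ℤ
    L b = ∑[ j < n ] (b j * c (suc j))
    a : ℕ → ℤ
    a k = + 2 * + ((2 ℕ.* p) C (2 ℕ.* k)) * (c₀ * c₀) ^ k

module HadamardMoments {N : ℕ} (H : Fin N → Fin N → ℤ) (isHadamard : IsHadamard N H) where
  import Data.Nat as ℕ
  import Data.Nat.Properties as ℕ
  import Data.Nat.Tactic.RingSolver as ℕ
  open import Data.Integer hiding (suc)
  open import Data.Integer.Properties
  open import Data.Integer.Tactic.RingSolver using (solve-∀)
  open import Data.Product using (proj₁; proj₂)
  open import Function using (_∘_)
  open import Relation.Binary.PropositionalEquality
  open import Algebra.Properties.Semiring.Sum +-*-semiring using (sum; sum-cong-≗; *-distribˡ-sum; sum-syntax; ∑-comm)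
  import Algebra.Properties.Semiring.Sum ℕ.+-*-semiring as ℕΣ
  open Combinatorics using (D)
  open Khintchine using (rademacherSum; rademacherSum≤gaussian; gaussian≤rademacherSum+error; K; K*s^[p∸2]*s²≡K*s^p)
  open IntegerSums
  open SignSums

  signedColumnSum : (Fin N → ℤ) → Fin N → ℤ
  signedColumnSum a j = ∑[ i < N ] (a i * H i j)

  Omega≡∑b*signedColumnSum : ∀ a b → Omega N H a b ≡ ∑[ j < N ] (b j * signedColumnSum a j)
  Omega≡∑b*signedColumnSum a b = begin
    Omega N H a b
      ≡⟨ trans (sumFin≡sum N _) (sum-cong-≗ {N} (λ i → sumFin≡sum N (λ j → a i * b j * H i j))) ⟩
    ∑[ i < N ] ∑[ j < N ] (a i * b j * H i j)
      ≡⟨ ∑-comm (λ i j → a i * b j * H i j) ⟩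
    ∑[ j < N ] ∑[ i < N ] (a i * b j * H i j)
      ≡⟨ sum-cong-≗ {N} (λ j → trans (sum-cong-≗ {N} (λ i → regroup (a i) (b j) (H i j)))
                                     (sym (*-distribˡ-sum (b j) (λ i → a i * H i j)))) ⟩
    ∑[ j < N ] (b j * signedColumnSum a j)
      ∎
    where
    open ≡-Reasoning
    regroup : ∀ a b h → a * b * h ≡ b * (a * h)
    regroup = solve-∀

  ∑signedColumnSum² : ∀ a → IsSignVector a → ∑[ j < N ] (signedColumnSum a j * signedColumnSum a j) ≡ + N * + N
  ∑signedColumnSum² a a± = begin
    ∑[ j < N ] (signedColumnSum a j * signedColumnSum a j)
      ≡⟨ sum-cong-≗ {N} (λ j → trans (sum*sum (λ i → a i * H i j) (λ i → a i * H i j))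
                          (sum-cong-≗ {N} (λ i → sum-cong-≗ {N} (λ i′ → regroup (a i) (H i j) (a i′) (H i′ j))))) ⟩
    ∑[ j < N ] ∑[ i < N ] ∑[ i′ < N ] (a i * a i′ * (H i j * H i′ j))
      ≡⟨ ∑-comm (λ j i → ∑[ i′ < N ] (a i * a i′ * (H i j * H i′ j))) ⟩
    ∑[ i < N ] ∑[ j < N ] ∑[ i′ < N ] (a i * a i′ * (H i j * H i′ j))
      ≡⟨ sum-cong-≗ {N} (λ i → trans (∑-comm (λ j i′ → a i * a i′ * (H i j * H i′ j)))
                          (sum-cong-≗ {N} (λ i′ → sym (*-distribˡ-sum (a i * a i′) (λ j → H i j * H i′ j))))) ⟩
    ∑[ i < N ] ∑[ i′ < N ] (a i * a i′ * rowProduct i i′)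
      ≡⟨ sum-cong-≗ {N} (λ i → sum-δ _ i (λ i′ i′≢i → trans (cong (a i * a i′ *_) (orthogonal i′≢i)) (*-zeroʳ (a i * a i′)))) ⟩
    ∑[ i < N ] (a i * a i * rowProduct i i)
      ≡⟨ sum-cong-≗ {N} (λ i → cong₂ _*_ (sign*sign≡1 (a± i))
                                         (trans (sum-cong-≗ {N} (λ j → sign*sign≡1 (proj₁ isHadamard i j))) (sum-const N (+ 1)))) ⟩
    ∑[ i < N ] (+ 1 * (+ N * + 1))
      ≡⟨ sum-const N _ ⟩
    + N * (+ 1 * (+ N * + 1))
      ≡⟨ cong (+ N *_) (trans (*-identityˡ _) (*-identityʳ (+ N))) ⟩
    + N * + N
      ∎
    where
    open ≡-Reasoning
    rowProduct : Fin N → Fin N → ℤ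
    rowProduct i i′ = ∑[ j < N ] (H i j * H i′ j)
    orthogonal : ∀ {i i′} → i′ ≢ i → rowProduct i i′ ≡ 0ℤ
    orthogonal i′≢i = trans (sym (sumFin≡sum N _)) (proj₂ isHadamard _ _ (i′≢i ∘ sym))
    regroup : ∀ a h a′ h′ → a * h * (a′ * h′) ≡ a * a′ * (h * h′)
    regroup = solve-∀

  squares : (Fin N → ℤ) → Fin N → ℕ
  squares a j = ∣ signedColumnSum a j ∣ ℕ.* ∣ signedColumnSum a j ∣

  ∑squares≡N² : ∀ a → IsSignVector a → ℕΣ.sum (squares a) ≡ N ℕ.* N
  ∑squares≡N² a a± = +-injective (begin
    + ℕΣ.sum (squares a)                                      ≡⟨ pos-sum (squares a) ⟩
    ∑[ j < N ] (+ squares a j)                                ≡⟨ sum-cong-≗ {N} (λ j → +∣i∣*∣i∣≡i*i (signedColumnSum a j)) ⟩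
    ∑[ j < N ] (signedColumnSum a j * signedColumnSum a j)    ≡⟨ ∑signedColumnSum² a a± ⟩
    + N * + N                                                 ≡⟨ sym (pos-* N N) ⟩
    + (N ℕ.* N)                                               ∎)
    where open ≡-Reasoning

  sumFourthPowers : (Fin N → ℤ) → ℕ
  sumFourthPowers a = ℕΣ.sum (λ j → squares a j ℕ.* squares a j)

  sumSigns-sumFourthPowers≤ : sumSigns N (λ a → + sumFourthPowers a) ≤ + (N ℕ.* (2 ℕ.^ N ℕ.* (3 ℕ.* (N ℕ.* N))))
  sumSigns-sumFourthPowers≤ = begin
    sumSigns N (λ a → + sumFourthPowers a)
      ≡⟨ sumSigns-cong N (λ a _ → trans (pos-sum {N} (λ j → squares a j ℕ.* squares a j))
                                        (sum-cong-≗ {N} (λ j → fourthPower (signedColumnSum a j)))) ⟩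
    sumSigns N (λ a → ∑[ j < N ] (signedColumnSum a j ^ (2 ℕ.* 2)))
      ≡⟨ sumSigns-sum N {N} (λ j a → signedColumnSum a j ^ (2 ℕ.* 2)) ⟩
    ∑[ j < N ] sumSigns N (λ a → signedColumnSum a j ^ (2 ℕ.* 2))
      ≡⟨ sum-cong-≗ {N} (λ j → sumSigns-evenPower N (λ i → H i j) 2) ⟩
    ∑[ j < N ] (+ rademacherSum N (λ i → ∣ H i j ∣ ℕ.* ∣ H i j ∣) 2)
      ≤⟨ sum-mono-≤ {N} (λ j → +≤+ (subst (λ s → rademacherSum N _ 2 ℕ.≤ 2 ℕ.^ N ℕ.* (3 ℕ.* (s ℕ.* (s ℕ.* 1))))
                                          (∑∣sign∣²≡n (λ i → H i j) (λ i → proj₁ isHadamard i j))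
                                          (rademacherSum≤gaussian N (λ i → ∣ H i j ∣ ℕ.* ∣ H i j ∣) 2))) ⟩
    ∑[ j < N ] (+ (2 ℕ.^ N ℕ.* (3 ℕ.* (N ℕ.* (N ℕ.* 1)))))
      ≡⟨ trans (sum-const N _) (sym (pos-* N _)) ⟩
    + (N ℕ.* (2 ℕ.^ N ℕ.* (3 ℕ.* (N ℕ.* (N ℕ.* 1)))))
      ≡⟨ cong (λ m → + (N ℕ.* (2 ℕ.^ N ℕ.* (3 ℕ.* (N ℕ.* m))))) (ℕ.*-identityʳ N) ⟩
    + (N ℕ.* (2 ℕ.^ N ℕ.* (3 ℕ.* (N ℕ.* N))))
      ∎
    where
    open ≤-Reasoning
    expand : ∀ c → c * c * (c * c) ≡ c * (c * (c * (c * + 1)))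
    expand = solve-∀
    fourthPower : ∀ c → + (∣ c ∣ ℕ.* ∣ c ∣ ℕ.* (∣ c ∣ ℕ.* ∣ c ∣)) ≡ c ^ (2 ℕ.* 2)
    fourthPower c = trans (pos-* (∣ c ∣ ℕ.* ∣ c ∣) _) (trans (cong₂ _*_ (+∣i∣*∣i∣≡i*i c) (+∣i∣*∣i∣≡i*i c)) (expand c))

  integratedMoment : ℕ → ℤ
  integratedMoment p = sumSigns N (λ a → sumSigns N (λ b → Omega N H a b ^ (2 ℕ.* p)))

  integratedMoment≡∑rademacherSum : ∀ p → integratedMoment p ≡ sumSigns N (λ a → + rademacherSum N (squares a) p)
  integratedMoment≡∑rademacherSum p = sumSigns-cong N (λ a _ → trans
    (sumSigns-cong N (λ b _ → cong (_^ (2 ℕ.* p)) (Omega≡∑b*signedColumnSum a b)))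
    (sumSigns-evenPower N (signedColumnSum a) p))

  totalWeight : ℕ → ℕ
  totalWeight p = 2 ℕ.^ N ℕ.* (2 ℕ.^ N ℕ.* (N ℕ.* N) ℕ.^ p)

  integratedMoment≤ : ∀ p → integratedMoment p ≤ + (D p ℕ.* totalWeight p)
  integratedMoment≤ p = begin
    integratedMoment p
      ≡⟨ integratedMoment≡∑rademacherSum p ⟩
    sumSigns N (λ a → + rademacherSum N (squares a) p)
      ≤⟨ sumSigns-mono-≤ N (λ a a± → +≤+ (subst (λ s → rademacherSum N (squares a) p ℕ.≤ 2 ℕ.^ N ℕ.* (D p ℕ.* s ℕ.^ p))
                                                 (∑squares≡N² a a±) (rademacherSum≤gaussian N (squares a) p))) ⟩
    sumSigns N (λ _ → + (2 ℕ.^ N ℕ.* (D p ℕ.* (N ℕ.* N) ℕ.^ p)))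
      ≡⟨ trans (sumSigns-const N _) (sym (pos-* (2 ℕ.^ N) _)) ⟩
    + (2 ℕ.^ N ℕ.* (2 ℕ.^ N ℕ.* (D p ℕ.* (N ℕ.* N) ℕ.^ p)))
      ≡⟨ cong +_ (regroup (2 ℕ.^ N) (D p) ((N ℕ.* N) ℕ.^ p)) ⟩
    + (D p ℕ.* totalWeight p)
      ∎
    where
    open ≤-Reasoning
    regroup : ∀ t d s → t ℕ.* (t ℕ.* (d ℕ.* s)) ≡ d ℕ.* (t ℕ.* (t ℕ.* s))
    regroup = ℕ.solve-∀

  errorSum : ℕ → ℤ
  errorSum p = sumSigns N (λ a → + (2 ℕ.^ N ℕ.* (K p ℕ.* (sumFourthPowers a ℕ.* (N ℕ.* N) ℕ.^ (p ℕ.∸ 2)))))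

  integratedMoment+errorSum≥ : ∀ p → + (D p ℕ.* totalWeight p) ≤ integratedMoment p + errorSum p
  integratedMoment+errorSum≥ p = begin
    + (D p ℕ.* totalWeight p)
      ≡⟨ cong +_ (regroup (2 ℕ.^ N) (D p) ((N ℕ.* N) ℕ.^ p)) ⟩
    + (2 ℕ.^ N ℕ.* (D p ℕ.* (2 ℕ.^ N ℕ.* (N ℕ.* N) ℕ.^ p)))
      ≡⟨ trans (pos-* (2 ℕ.^ N) _) (sym (sumSigns-const N _)) ⟩
    sumSigns N (λ _ → + (D p ℕ.* (2 ℕ.^ N ℕ.* (N ℕ.* N) ℕ.^ p)))
      ≤⟨ sumSigns-mono-≤ N (λ a a± → +≤+ (subst (λ s → D p ℕ.* (2 ℕ.^ N ℕ.* s ℕ.^ p) ℕ.≤ rademacherSum N (squares a) p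
                                                         ℕ.+ 2 ℕ.^ N ℕ.* (K p ℕ.* (sumFourthPowers a ℕ.* s ℕ.^ (p ℕ.∸ 2))))
                                                 (∑squares≡N² a a±) (gaussian≤rademacherSum+error N (squares a) p))) ⟩
    sumSigns N (λ a → + (rademacherSum N (squares a) p ℕ.+ 2 ℕ.^ N ℕ.* (K p ℕ.* (sumFourthPowers a ℕ.* (N ℕ.* N) ℕ.^ (p ℕ.∸ 2)))))
      ≡⟨ trans (sumSigns-cong N (λ a _ → pos-+ (rademacherSum N (squares a) p) _)) (sumSigns-+ N _ _) ⟩
    sumSigns N (λ a → + rademacherSum N (squares a) p) + errorSum p
      ≡⟨ cong (_+ errorSum p) (sym (integratedMoment≡∑rademacherSum p)) ⟩
    integratedMoment p + errorSum p
      ∎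
    where
    open ≤-Reasoning
    regroup : ∀ t d u → d ℕ.* (t ℕ.* (t ℕ.* u)) ≡ t ℕ.* (d ℕ.* (t ℕ.* u))
    regroup = ℕ.solve-∀

  N*errorSum≤ : ∀ p → + N * errorSum p ≤ + (3 ℕ.* K p ℕ.* totalWeight p)
  N*errorSum≤ p = begin
    + N * errorSum p
      ≡⟨ cong (+ N *_) (trans (sumSigns-cong N (λ a _ → trans (cong +_ (regroup₁ (2 ℕ.^ N) (K p) (sumFourthPowers a) (s ℕ.^ (p ℕ.∸ 2))))
                                                                (pos-* c (sumFourthPowers a))))
                              (sumSigns-*ˡ N (+ c) _)) ⟩
    + N * (+ c * sumSigns N (λ a → + sumFourthPowers a))
      ≤⟨ *-monoˡ-≤-nonNeg (+ N) (*-monoˡ-≤-nonNeg (+ c) sumSigns-sumFourthPowers≤) ⟩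
    + N * (+ c * + (N ℕ.* (2 ℕ.^ N ℕ.* (3 ℕ.* s))))
      ≡⟨ trans (cong (+ N *_) (sym (pos-* c _))) (sym (pos-* N _)) ⟩
    + (N ℕ.* (c ℕ.* (N ℕ.* (2 ℕ.^ N ℕ.* (3 ℕ.* s)))))
      ≡⟨ cong +_ (regroup₂ N (2 ℕ.^ N) (K p) (s ℕ.^ (p ℕ.∸ 2))) ⟩
    + (3 ℕ.* (2 ℕ.^ N ℕ.* (2 ℕ.^ N ℕ.* (K p ℕ.* (s ℕ.^ (p ℕ.∸ 2) ℕ.* (s ℕ.* s))))))
      ≡⟨ cong (λ m → + (3 ℕ.* (2 ℕ.^ N ℕ.* (2 ℕ.^ N ℕ.* m)))) (K*s^[p∸2]*s²≡K*s^p p s) ⟩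
    + (3 ℕ.* (2 ℕ.^ N ℕ.* (2 ℕ.^ N ℕ.* (K p ℕ.* s ℕ.^ p))))
      ≡⟨ cong +_ (regroup₃ (2 ℕ.^ N) (K p) (s ℕ.^ p)) ⟩
    + (3 ℕ.* K p ℕ.* totalWeight p)
      ∎
    where
    open ≤-Reasoning
    s = N ℕ.* N
    c = 2 ℕ.^ N ℕ.* K p ℕ.* s ℕ.^ (p ℕ.∸ 2)
    regroup₁ : ∀ t k f u → t ℕ.* (k ℕ.* (f ℕ.* u)) ≡ t ℕ.* k ℕ.* u ℕ.* f
    regroup₁ = ℕ.solve-∀
    regroup₂ : ∀ N t k u → N ℕ.* (t ℕ.* k ℕ.* u ℕ.* (N ℕ.* (t ℕ.* (3 ℕ.* (N ℕ.* N)))))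
                         ≡ 3 ℕ.* (t ℕ.* (t ℕ.* (k ℕ.* (u ℕ.* ((N ℕ.* N) ℕ.* (N ℕ.* N))))))
    regroup₂ = ℕ.solve-∀
    regroup₃ : ∀ t k u → 3 ℕ.* (t ℕ.* (t ℕ.* (k ℕ.* u))) ≡ 3 ℕ.* k ℕ.* (t ℕ.* (t ℕ.* u))
    regroup₃ = ℕ.solve-∀

  N*integratedMoment≥ : ∀ p → + (N ℕ.* (D p ℕ.* totalWeight p)) ≤ + N * integratedMoment p + + (3 ℕ.* K p ℕ.* totalWeight p)
  N*integratedMoment≥ p = begin
    + (N ℕ.* (D p ℕ.* totalWeight p))            ≡⟨ pos-* N _ ⟩
    + N * + (D p ℕ.* totalWeight p)              ≤⟨ *-monoˡ-≤-nonNeg (+ N) (integratedMoment+errorSum≥ p) ⟩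
    + N * (integratedMoment p + errorSum p)      ≡⟨ *-distribˡ-+ (+ N) (integratedMoment p) (errorSum p) ⟩
    + N * integratedMoment p + + N * errorSum p  ≤⟨ +-monoʳ-≤ (+ N * integratedMoment p) (N*errorSum≤ p) ⟩
    + N * integratedMoment p + + (3 ℕ.* K p ℕ.* totalWeight p)  ∎
    where open ≤-Reasoning

module Rationals where
  open import Data.Nat as ℕ using (zero; suc)
  open import Data.Integer as ℤ using (+_; -1ℤ)
  import Data.Integer.Properties as ℤ
  import Data.Integer.Tactic.RingSolver as ℤ
  open import Data.Rational
  open import Data.Rational.Properties
  open import Data.Rational.Solver using (module +-*-Solver)
  import Data.Rational.Unnormalised as ℚᵘ
  import Data.Rational.Unnormalised.Properties as ℚᵘ
  open import Function using (_∘_)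
  open import Relation.Binary.PropositionalEquality
  open +-*-Solver using (solve; _:=_; _:+_; _:*_; _:-_; :-_)
  open SignSums using (sumSigns)

  fromℚᵘ-+ : ∀ p q → fromℚᵘ (p ℚᵘ.+ q) ≡ fromℚᵘ p + fromℚᵘ q
  fromℚᵘ-+ p q = toℚᵘ-injective (ℚᵘ.≃-trans (toℚᵘ-fromℚᵘ (p ℚᵘ.+ q))
    (ℚᵘ.≃-sym (ℚᵘ.≃-trans (toℚᵘ-homo-+ (fromℚᵘ p) (fromℚᵘ q)) (ℚᵘ.+-cong (toℚᵘ-fromℚᵘ p) (toℚᵘ-fromℚᵘ q)))))

  fromℚᵘ-* : ∀ p q → fromℚᵘ (p ℚᵘ.* q) ≡ fromℚᵘ p * fromℚᵘ q
  fromℚᵘ-* p q = toℚᵘ-injective (ℚᵘ.≃-trans (toℚᵘ-fromℚᵘ (p ℚᵘ.* q))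
    (ℚᵘ.≃-sym (ℚᵘ.≃-trans (toℚᵘ-homo-* (fromℚᵘ p) (fromℚᵘ q)) (ℚᵘ.*-cong (toℚᵘ-fromℚᵘ p) (toℚᵘ-fromℚᵘ q)))))

  ι : ℤ → ℚ
  ι z = z / 1

  ι-+ : ∀ a b → ι (a ℤ.+ b) ≡ ι a + ι b
  ι-+ a b = trans (fromℚᵘ-cong {(a ℤ.+ b) ℚᵘ./ 1} {(a ℚᵘ./ 1) ℚᵘ.+ (b ℚᵘ./ 1)} (ℚᵘ.*≡* (normalise a b)))
                  (fromℚᵘ-+ (a ℚᵘ./ 1) (b ℚᵘ./ 1))
    where
    normalise : ∀ a b → (a ℤ.+ b) ℤ.* (+ 1 ℤ.* + 1) ≡ (a ℤ.* + 1 ℤ.+ b ℤ.* + 1) ℤ.* + 1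
    normalise = ℤ.solve-∀

  ι-* : ∀ a b → ι (a ℤ.* b) ≡ ι a * ι b
  ι-* a b = fromℚᵘ-* (a ℚᵘ./ 1) (b ℚᵘ./ 1)

  ι-pos-* : ∀ m n → ι (+ (m ℕ.* n)) ≡ ι (+ m) * ι (+ n)
  ι-pos-* m n = trans (cong ι (ℤ.pos-* m n)) (ι-* (+ m) (+ n))

  ι-mono-≤ : ∀ {a b} → a ℤ.≤ b → ι a ≤ ι b
  ι-mono-≤ {a} {b} a≤b = toℚᵘ-cancel-≤ (ℚᵘ.≤-respˡ-≃ (ℚᵘ.≃-sym (toℚᵘ-fromℚᵘ (a ℚᵘ./ 1)))
    (ℚᵘ.≤-respʳ-≃ (ℚᵘ.≃-sym (toℚᵘ-fromℚᵘ (b ℚᵘ./ 1))) (ℚᵘ.*≤* (ℤ.*-monoʳ-≤-nonNeg (+ 1) a≤b))))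

  z/n≡ι[z]*1/n : ∀ z n .{{_ : ℕ.NonZero n}} → z / n ≡ ι z * (+ 1 / n)
  z/n≡ι[z]*1/n z (suc m) =
    trans (fromℚᵘ-cong {z ℚᵘ./ suc m} {(z ℚᵘ./ 1) ℚᵘ.* (+ 1 ℚᵘ./ suc m)} (ℚᵘ.*≡* (normalise z (+ suc m))))
          (fromℚᵘ-* (z ℚᵘ./ 1) (+ 1 ℚᵘ./ suc m))
    where
    normalise : ∀ z n → z ℤ.* (+ 1 ℤ.* n) ≡ z ℤ.* + 1 ℤ.* n
    normalise = ℤ.solve-∀

  1/n*n≡1 : ∀ n .{{_ : ℕ.NonZero n}} → (+ 1 / n) * ι (+ n) ≡ 1ℚ
  1/n*n≡1 (suc m) =
    trans (sym (fromℚᵘ-* (+ 1 ℚᵘ./ suc m) (+ suc m ℚᵘ./ 1)))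
          (fromℚᵘ-cong {(+ 1 ℚᵘ./ suc m) ℚᵘ.* (+ suc m ℚᵘ./ 1)} {ℚᵘ.1ℚᵘ} (ℚᵘ.*≡* (normalise (+ suc m))))
    where
    normalise : ∀ n → + 1 ℤ.* n ℤ.* + 1 ≡ + 1 ℤ.* (n ℤ.* + 1)
    normalise = ℤ.solve-∀

  interchange : ∀ a b c d → a * b * (c * d) ≡ a * c * (b * d)
  interchange = solve 4 (λ a b c d → a :* b :* (c :* d) := a :* c :* (b :* d)) refl

  powℚ-* : ∀ p q k → powℚ (p * q) k ≡ powℚ p k * powℚ q k
  powℚ-* p q zero    = refl
  powℚ-* p q (suc k) = trans (cong ((p * q) *_) (powℚ-* p q k)) (interchange p q (powℚ p k) (powℚ q k))

  powℚ-ι : ∀ z k → powℚ (ι z) k ≡ ι (z ℤ.^ k)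
  powℚ-ι z zero    = refl
  powℚ-ι z (suc k) = trans (cong (ι z *_) (powℚ-ι z k)) (sym (ι-* z (z ℤ.^ k)))

  powℚ-inverse : ∀ q n → q * ι (+ n) ≡ 1ℚ → ∀ k → powℚ q k * ι (+ (n ℕ.^ k)) ≡ 1ℚ
  powℚ-inverse q n q*n≡1 zero    = refl
  powℚ-inverse q n q*n≡1 (suc k) = begin
    q * powℚ q k * ι (+ (n ℕ.* n ℕ.^ k))         ≡⟨ cong (q * powℚ q k *_) (ι-pos-* n (n ℕ.^ k)) ⟩
    q * powℚ q k * (ι (+ n) * ι (+ (n ℕ.^ k)))   ≡⟨ interchange q (powℚ q k) (ι (+ n)) _ ⟩
    q * ι (+ n) * (powℚ q k * ι (+ (n ℕ.^ k)))   ≡⟨ cong₂ _*_ q*n≡1 (powℚ-inverse q n q*n≡1 k) ⟩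
    1ℚ                                           ∎
    where open ≡-Reasoning

  powℚ-nonNeg : ∀ q .{{_ : NonNegative q}} k → NonNegative (powℚ q k)
  powℚ-nonNeg q zero    = _
  powℚ-nonNeg q (suc k) = nonNeg*nonNeg⇒nonNeg q (powℚ q k) {{powℚ-nonNeg q k}}

  avgSigns-cong : ∀ n {f g : (Fin n → ℤ) → ℚ} → (∀ a → f a ≡ g a) → avgSigns n f ≡ avgSigns n g
  avgSigns-cong zero    f≡g = f≡g _
  avgSigns-cong (suc n) f≡g =
    cong₂ (λ s t → ½ * (s + t)) (avgSigns-cong n (f≡g ∘ cons (+ 1))) (avgSigns-cong n (f≡g ∘ cons -1ℤ))

  avgSigns≡ι[sumSigns]*½^n : ∀ n (g : (Fin n → ℤ) → ℤ) κ →
    avgSigns n (λ b → ι (g b) * κ) ≡ ι (sumSigns n g) * (powℚ ½ n * κ)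
  avgSigns≡ι[sumSigns]*½^n zero    g κ = cong (ι (g (λ ())) *_) (sym (*-identityˡ κ))
  avgSigns≡ι[sumSigns]*½^n (suc n) g κ = begin
    ½ * (avgSigns n (λ b → ι (g (cons (+ 1) b)) * κ) + avgSigns n (λ b → ι (g (cons -1ℤ b)) * κ))
      ≡⟨ cong₂ (λ s t → ½ * (s + t)) (avgSigns≡ι[sumSigns]*½^n n (g ∘ cons (+ 1)) κ)
                                     (avgSigns≡ι[sumSigns]*½^n n (g ∘ cons -1ℤ) κ) ⟩
    ½ * (ι S₊ * (powℚ ½ n * κ) + ι S₋ * (powℚ ½ n * κ))
      ≡⟨ regroup ½ (ι S₊) (ι S₋) (powℚ ½ n) κ ⟩
    (ι S₊ + ι S₋) * (½ * powℚ ½ n * κ)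
      ≡⟨ cong (_* (½ * powℚ ½ n * κ)) (sym (ι-+ S₊ S₋)) ⟩
    ι (S₊ ℤ.+ S₋) * (½ * powℚ ½ n * κ)
      ∎
    where
    open ≡-Reasoning
    S₊ = sumSigns n (g ∘ cons (+ 1))
    S₋ = sumSigns n (g ∘ cons -1ℤ)
    regroup : ∀ h s t w κ → h * (s * (w * κ) + t * (w * κ)) ≡ (s + t) * (h * w * κ)
    regroup = solve 5 (λ h s t w κ → h :* (s :* (w :* κ) :+ t :* (w :* κ)) := (s :+ t) :* (h :* w :* κ)) refl

  ν*x≤ν*y+f⇒x≤y+μ*f : ∀ {x y f ν μ} .{{_ : NonNegative μ}} → μ * ν ≡ 1ℚ → ν * x ≤ ν * y + f → x ≤ y + μ * f
  ν*x≤ν*y+f⇒x≤y+μ*f {x} {y} {f} {ν} {μ} μ*ν≡1 νx≤νy+f = begin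
    x                    ≡⟨ sym (trans (cong (_* x) μ*ν≡1) (*-identityˡ x)) ⟩
    μ * ν * x            ≡⟨ *-assoc μ ν x ⟩
    μ * (ν * x)          ≤⟨ *-monoˡ-≤-nonNeg μ νx≤νy+f ⟩
    μ * (ν * y + f)      ≡⟨ regroup μ ν y f ⟩
    μ * ν * y + μ * f    ≡⟨ cong (λ t → t * y + μ * f) μ*ν≡1 ⟩
    1ℚ * y + μ * f       ≡⟨ cong (_+ μ * f) (*-identityˡ y) ⟩
    y + μ * f            ∎
    where
    open ≤-Reasoning
    regroup : ∀ μ ν y f → μ * (ν * y + f) ≡ μ * ν * y + μ * f
    regroup = solve 4 (λ μ ν y f → μ :* (ν :* y :+ f) := μ :* ν :* y :+ μ :* f) refl

  ∣y*κ-x*κ∣≤e*κ : ∀ {x y e κ} .{{_ : NonNegative κ}} → y ≤ x → x ≤ y + e → ∣ y * κ - x * κ ∣ ≤ e * κ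
  ∣y*κ-x*κ∣≤e*κ {x} {y} {e} {κ} y≤x x≤y+e = begin
    ∣ y * κ - x * κ ∣      ≡⟨ cong ∣_∣ (regroup y x κ) ⟩
    ∣ - ((x - y) * κ) ∣    ≡⟨ ∣-p∣≡∣p∣ ((x - y) * κ) ⟩
    ∣ (x - y) * κ ∣        ≡⟨ 0≤p⇒∣p∣≡p (nonNegative⁻¹ _ {{nonNeg*nonNeg⇒nonNeg (x - y) {{nonNegative 0≤x-y}} κ}}) ⟩
    (x - y) * κ            ≤⟨ *-monoʳ-≤-nonNeg κ x-y≤e ⟩
    e * κ                  ∎
    where
    open ≤-Reasoning
    regroup : ∀ y x κ → y * κ - x * κ ≡ - ((x - y) * κ)
    regroup = solve 3 (λ y x κ → y :* κ :- x :* κ := :- ((x :- y) :* κ)) refl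
    cancel : ∀ y e → y + e - y ≡ e
    cancel = solve 2 (λ y e → y :+ e :- y := e) refl
    0≤x-y : 0ℚ ≤ x - y
    0≤x-y = ≤-trans (≤-reflexive (sym (+-inverseʳ y))) (+-monoˡ-≤ (- y) y≤x)
    x-y≤e : x - y ≤ e
    x-y≤e = ≤-trans (+-monoˡ-≤ (- y) x≤y+e) (≤-reflexive (cancel y e))

module RationalMoment {N : ℕ} .{{_ : NonZero N}} (H : Fin N → Fin N → ℤ) (isHadamard : IsHadamard N H) where
  open import Data.Nat as ℕ using ()
  import Data.Nat.Properties as ℕ
  open import Data.Integer as ℤ using (+_)
  open import Data.Rational
  open import Data.Rational.Properties
  open import Data.Rational.Solver using (module +-*-Solver)
  open import Relation.Binary.PropositionalEquality
  open +-*-Solver using (solve; _:=_; _:*_)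
  open Combinatorics using (D)
  open Khintchine using (K)
  open SignSums using (sumSigns)
  open HadamardMoments H isHadamard
  open Rationals

  -- 1 / totalWeight p, in the form in which avgSigns and powℚ (Ω / N) produce it.
  κ : ℕ → ℚ
  κ p = powℚ ½ N * (powℚ ½ N * powℚ (+ 1 / N) (2 ℕ.* p))

  moment≡ι[integratedMoment]*κ : ∀ p → moment N H p ≡ ι (integratedMoment p) * κ p
  moment≡ι[integratedMoment]*κ p = trans
    (avgSigns-cong N (λ a → trans (avgSigns-cong N (Ω/N^[2p] a))
                                  (avgSigns≡ι[sumSigns]*½^n N (λ b → Ω a b ℤ.^ (2 ℕ.* p)) _)))
    (avgSigns≡ι[sumSigns]*½^n N (λ a → sumSigns N (λ b → Ω a b ℤ.^ (2 ℕ.* p))) _)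
    where
    open ≡-Reasoning
    Ω = Omega N H
    Ω/N^[2p] : ∀ a b → powℚ (Ω a b / N) (2 ℕ.* p) ≡ ι (Ω a b ℤ.^ (2 ℕ.* p)) * powℚ (+ 1 / N) (2 ℕ.* p)
    Ω/N^[2p] a b = begin
      powℚ (Ω a b / N) (2 ℕ.* p)                             ≡⟨ cong (λ q → powℚ q (2 ℕ.* p)) (z/n≡ι[z]*1/n (Ω a b) N) ⟩
      powℚ (ι (Ω a b) * (+ 1 / N)) (2 ℕ.* p)                 ≡⟨ powℚ-* (ι (Ω a b)) (+ 1 / N) (2 ℕ.* p) ⟩
      powℚ (ι (Ω a b)) (2 ℕ.* p) * powℚ (+ 1 / N) (2 ℕ.* p)  ≡⟨ cong (_* powℚ (+ 1 / N) (2 ℕ.* p)) (powℚ-ι (Ω a b) (2 ℕ.* p)) ⟩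
      ι (Ω a b ℤ.^ (2 ℕ.* p)) * powℚ (+ 1 / N) (2 ℕ.* p)     ∎

  κ*totalWeight≡1 : ∀ p → κ p * ι (+ totalWeight p) ≡ 1ℚ
  κ*totalWeight≡1 p = begin
    κ p * ι (+ totalWeight p)
      ≡⟨ cong (κ p *_) (trans (ι-pos-* (2 ℕ.^ N) _) (cong (ι (+ (2 ℕ.^ N)) *_) (ι-pos-* (2 ℕ.^ N) _))) ⟩
    κ p * (ι (+ (2 ℕ.^ N)) * (ι (+ (2 ℕ.^ N)) * ι (+ ((N ℕ.* N) ℕ.^ p))))
      ≡⟨ regroup (powℚ ½ N) (powℚ (+ 1 / N) (2 ℕ.* p)) (ι (+ (2 ℕ.^ N))) (ι (+ ((N ℕ.* N) ℕ.^ p))) ⟩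
    (powℚ ½ N * ι (+ (2 ℕ.^ N))) * ((powℚ ½ N * ι (+ (2 ℕ.^ N))) * (powℚ (+ 1 / N) (2 ℕ.* p) * ι (+ ((N ℕ.* N) ℕ.^ p))))
      ≡⟨ cong₂ (λ h t → h * (h * t)) (powℚ-inverse ½ 2 refl N)
               (trans (cong (λ m → powℚ (+ 1 / N) (2 ℕ.* p) * ι (+ m)) N²^p≡N^[2p])
                      (powℚ-inverse (+ 1 / N) N (1/n*n≡1 N) (2 ℕ.* p))) ⟩
    1ℚ * (1ℚ * 1ℚ)
      ∎
    where
    open ≡-Reasoning
    regroup : ∀ h k a s → h * (h * k) * (a * (a * s)) ≡ h * a * (h * a * (k * s))
    regroup = solve 4 (λ h k a s → h :* (h :* k) :* (a :* (a :* s)) := h :* a :* (h :* a :* (k :* s))) refl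
    N²^p≡N^[2p] : (N ℕ.* N) ℕ.^ p ≡ N ℕ.^ (2 ℕ.* p)
    N²^p≡N^[2p] = trans (cong (ℕ._^ p) (cong (N ℕ.*_) (sym (ℕ.*-identityʳ N)))) (ℕ.^-*-assoc N 2 p)

  κ-nonNeg : ∀ p → NonNegative (κ p)
  κ-nonNeg p = nonNeg*nonNeg⇒nonNeg (powℚ ½ N) {{powℚ-nonNeg ½ N}} _
    {{nonNeg*nonNeg⇒nonNeg (powℚ ½ N) {{powℚ-nonNeg ½ N}} _ {{powℚ-nonNeg (+ 1 / N) {{normalize-nonNeg 1 N}} (2 ℕ.* p)}}}}

  ι[z*totalWeight]*κ≡ι[z] : ∀ z p → ι (+ (z ℕ.* totalWeight p)) * κ p ≡ ι (+ z)
  ι[z*totalWeight]*κ≡ι[z] z p = begin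
    ι (+ (z ℕ.* totalWeight p)) * κ p       ≡⟨ cong (_* κ p) (ι-pos-* z (totalWeight p)) ⟩
    ι (+ z) * ι (+ totalWeight p) * κ p     ≡⟨ regroup (ι (+ z)) (ι (+ totalWeight p)) (κ p) ⟩
    ι (+ z) * (κ p * ι (+ totalWeight p))   ≡⟨ cong (ι (+ z) *_) (κ*totalWeight≡1 p) ⟩
    ι (+ z) * 1ℚ                            ≡⟨ *-identityʳ (ι (+ z)) ⟩
    ι (+ z)                                 ∎
    where
    open ≡-Reasoning
    regroup : ∀ d w κ → d * w * κ ≡ d * (κ * w)
    regroup = solve 3 (λ d w κ → d :* w :* κ := d :* (κ :* w)) refl

  N*gaussian≤N*integratedMoment+error : ∀ p →
    ι (+ N) * ι (+ (D p ℕ.* totalWeight p)) ≤ ι (+ N) * ι (integratedMoment p) + ι (+ (3 ℕ.* K p ℕ.* totalWeight p))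
  N*gaussian≤N*integratedMoment+error p = begin
    ι (+ N) * ι (+ (D p ℕ.* totalWeight p))
      ≡⟨ sym (ι-pos-* N _) ⟩
    ι (+ (N ℕ.* (D p ℕ.* totalWeight p)))
      ≤⟨ ι-mono-≤ (N*integratedMoment≥ p) ⟩
    ι (+ N ℤ.* integratedMoment p ℤ.+ + (3 ℕ.* K p ℕ.* totalWeight p))
      ≡⟨ trans (ι-+ (+ N ℤ.* integratedMoment p) _)
               (cong (_+ ι (+ (3 ℕ.* K p ℕ.* totalWeight p))) (ι-* (+ N) (integratedMoment p))) ⟩
    ι (+ N) * ι (integratedMoment p) + ι (+ (3 ℕ.* K p ℕ.* totalWeight p))
      ∎
    where open ≤-Reasoning

  ∣moment-D∣≤3K/N : ∀ p → ∣ moment N H p - ι (+ D p) ∣ ≤ ι (+ (3 ℕ.* K p)) * (+ 1 / N)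
  ∣moment-D∣≤3K/N p = begin
    ∣ moment N H p - ι (+ D p) ∣
      ≡⟨ cong₂ (λ m d → ∣ m - d ∣) (moment≡ι[integratedMoment]*κ p) (sym (ι[z*totalWeight]*κ≡ι[z] (D p) p)) ⟩
    ∣ ι (integratedMoment p) * κ p - ι (+ (D p ℕ.* totalWeight p)) * κ p ∣
      ≤⟨ ∣y*κ-x*κ∣≤e*κ {{κ-nonNeg p}} (ι-mono-≤ (integratedMoment≤ p))
                       (ν*x≤ν*y+f⇒x≤y+μ*f {ν = ι (+ N)} {μ = + 1 / N} {{normalize-nonNeg 1 N}} (1/n*n≡1 N)
                                          (N*gaussian≤N*integratedMoment+error p)) ⟩
    (+ 1 / N) * ι (+ (3 ℕ.* K p ℕ.* totalWeight p)) * κ p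
      ≡⟨ regroup (+ 1 / N) (ι (+ (3 ℕ.* K p ℕ.* totalWeight p))) (κ p) ⟩
    ι (+ (3 ℕ.* K p ℕ.* totalWeight p)) * κ p * (+ 1 / N)
      ≡⟨ cong (_* (+ 1 / N)) (ι[z*totalWeight]*κ≡ι[z] (3 ℕ.* K p) p) ⟩
    ι (+ (3 ℕ.* K p)) * (+ 1 / N)
      ∎
    where
    open ≤-Reasoning
    regroup : ∀ μ f κ → μ * f * κ ≡ f * κ * μ
    regroup = solve 3 (λ μ f κ → μ :* f :* κ := f :* κ :* μ) refl

import Data.Nat as ℕ
open import Data.Integer using (+_)
open import Data.Rational using (ℚ; _/_; _≤_; _-_; ∣_∣; _*_)
open import Data.Product using (Σ; _,_)

theorem1p6 : (p : ℕ) → 1 ℕ.≤ p →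
    Σ ℚ (λ C → (N : ℕ) .{{_ : NonZero N}} → (H : Fin N → Fin N → ℤ) → IsHadamard N H →
      ∣ moment N H p - (+ oddDoubleFactorial p / 1) ∣ ≤ C * (+ 1 / N))
theorem1p6 p _ = Rationals.ι (+ (3 ℕ.* Khintchine.K p)) ,
  λ N H isHadamard → RationalMoment.∣moment-D∣≤3K/N H isHadamard p
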